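{- For $m\in\mathbb{Z}_{>0}$ and $j\in\{0,\dots,m\}$, the following are equivalent: (i) $\binom{m}{j}\not\equiv0\pmod p$; (ii) $\Delta(j+1,\ m+1-j,\ m)=0$.
   Context: Let $p$ be a prime, $\mathbb{F}=\mathbb{F}_p$, $S=\mathbb{F}[x,y]$, $\mathrm{Der}_S=S\partial_x\oplus S\partial_y$. Let $\mathcal{A}=\{H_1,H_2,H_3\}$ with $H_1=\ker x$, $H_2=\ker y$, $H_3=\ker(x+y)$, $\alpha_1=x,\alpha_2=y,\alpha_3=x+y$. For $\mu=(\mu_1,\mu_2,\mu_3)\in\mathbb{Z}_{\ge0}^3$, $D(\mathcal{A},\mu)=\{\theta\in\mathrm{Der}_S:\theta(\alpha_i)\in\alpha_i^{\mu_i}S,\ i=1,2,3\}$; it is free of rank 2 with a homogeneous basis whose degrees (exponents) are unique up to order; $\Delta(\mu)$ is the absolute difference of the two exponents. -}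

module Defs where

open import Data.Nat using (ℕ; zero; suc; _+_; _*_; _∸_; _≡ᵇ_; ∣_-_∣)
open import Data.Nat.Divisibility using (_∣_)
open import Data.Product using (Σ; _×_; _,_; ∃; ∃-syntax)
open import Data.Bool using (if_then_else_)
open import Relation.Binary.PropositionalEquality using (_≡_)
open import Relation.Nullary using (¬_)

-- Polynomials in S = F_p[x,y], represented by their coefficient functions:
-- c i j = coefficient of x^i y^j, a natural number read modulo p.
Coef : Set
Coef = ℕ → ℕ → ℕ

IsPoly : Coef → Set
IsPoly c = ∃[ N ] (∀ i j → N Data.Nat.≤ i + j → c i j ≡ 0)

Σ< : ℕ → (ℕ → ℕ) → ℕ
Σ< zero    f = 0
Σ< (suc n) f = Σ< n f + f n

-- ring operations on coefficient functions (over ℕ; reduced mod p via _≈_ below)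
zeroP : Coef
zeroP _ _ = 0

oneP : Coef
oneP i j = if (i + j) ≡ᵇ 0 then 1 else 0

X : Coef
X i j = if (i ≡ᵇ 1) then (if (j ≡ᵇ 0) then 1 else 0) else 0

Y : Coef
Y i j = if (i ≡ᵇ 0) then (if (j ≡ᵇ 1) then 1 else 0) else 0

_⊕_ : Coef → Coef → Coef
(f ⊕ g) i j = f i j + g i j

_⊗_ : Coef → Coef → Coef
(f ⊗ g) i j = Σ< (suc i) λ a → Σ< (suc j) λ b → f a b * g (i ∸ a) (j ∸ b)

_^P_ : Coef → ℕ → Coef
f ^P zero  = oneP
f ^P suc k = f ⊗ (f ^P k)

module _ (p : ℕ) where

  _≡ₚ_ : ℕ → ℕ → Set
  a ≡ₚ b = p ∣ ∣ a - b ∣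

  _≈_ : Coef → Coef → Set
  f ≈ g = ∀ i j → f i j ≡ₚ g i j

  InIdeal : Coef → Coef → Set
  InIdeal a t = ∃[ h ] (IsPoly h × (t ≈ (a ⊗ h)))

  HomP : ℕ → Coef → Set
  HomP d f = ∀ i j → ¬ (i + j ≡ d) → f i j ≡ₚ 0

-- Derivations θ = f ∂x + g ∂y, represented by the pair (f , g) = (θ(x), θ(y)).
Der : Set
Der = Coef × Coef

IsDer : Der → Set
IsDer (f , g) = IsPoly f × IsPoly g

-- multiplicities μ = (μ₁ , μ₂ , μ₃) for H₁ = ker x, H₂ = ker y, H₃ = ker (x+y)
Mult : Set
Mult = ℕ × ℕ × ℕ

module _ (p : ℕ) where

  InD : Mult → Der → Set
  InD (μ₁ , μ₂ , μ₃) θ@(f , g) =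
    IsDer θ × InIdeal p (X ^P μ₁) f × InIdeal p (Y ^P μ₂) g
            × InIdeal p ((X ⊕ Y) ^P μ₃) (f ⊕ g)

  _≈D_ : Der → Der → Set
  (f , g) ≈D (f' , g') = _≈_ p f f' × _≈_ p g g'

  lin : Coef → Der → Coef → Der → Der
  lin h₁ (f₁ , g₁) h₂ (f₂ , g₂) = ((h₁ ⊗ f₁) ⊕ (h₂ ⊗ f₂)) , ((h₁ ⊗ g₁) ⊕ (h₂ ⊗ g₂))

  IsBasis : Mult → Der → Der → Set
  IsBasis μ θ₁ θ₂ =
    InD μ θ₁ × InD μ θ₂
    × (∀ θ → InD μ θ → ∃[ h₁ ] ∃[ h₂ ] (IsPoly h₁ × IsPoly h₂ × (θ ≈D lin h₁ θ₁ h₂ θ₂)))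
    × (∀ h₁ h₂ → IsPoly h₁ → IsPoly h₂ → lin h₁ θ₁ h₂ θ₂ ≈D (zeroP , zeroP)
        → _≈_ p h₁ zeroP × _≈_ p h₂ zeroP)

  HomD : ℕ → Der → Set
  HomD d (f , g) = HomP p d f × HomP p d g

  HasExponents : Mult → ℕ → ℕ → Set
  HasExponents μ d₁ d₂ = ∃[ θ₁ ] ∃[ θ₂ ] (IsBasis μ θ₁ θ₂ × HomD d₁ θ₁ × HomD d₂ θ₂)

  -- Δ(μ) = δ  (exponents are unique up to order, so this determines Δ(μ))
  IsΔ : Mult → ℕ → Set
  IsΔ μ δ = ∃[ d₁ ] ∃[ d₂ ] (HasExponents μ d₁ d₂ × δ ≡ ∣ d₁ - d₂ ∣)

module Submission where

-- Let E = (x + y)^m and r = m - j, and split a polynomial into its terms of x-degree > j and ≤ j.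
-- If p ∤ (m C j), splitting x·E and y·E gives φ₁, φ₂ ∈ D(𝒜, μ) of degree m + 1 with
-- y·φ₁ - x·φ₂ = (M, -M), where M = (m C j) x^(j+1) y^(r+1) is the part of xyE of x-degree j + 1.
-- They are independent: h₁φ₁ + h₂φ₂ = 0 forces E(xh₁ + yh₂) = 0, hence (h₁, h₂) = (yt, -xt) and
-- tM = 0, so t = 0 as (m C j) is a unit.  They span: if θ(x) + θ(y) = Ec, subtracting the multiples
-- of φ₁, φ₂ given by the non-constant part of c leaves θ′ with θ′(x) + θ′(y) = c(0,0)E; looking at
-- x^j y^r shows c(0,0) = 0, so θ′(x) = -θ′(y) is divisible by x^(j+1) y^(r+1), i.e. θ′ is a multiple
-- of (M, -M).
-- If p ∣ (m C j), the split ψ of E itself lies in D(𝒜, μ); every homogeneous element of degree ≤ m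
-- is a constant multiple of ψ, and ψ (whose coefficient of x^m is 1) is not generated in degrees > m,
-- so there is no basis of two equal degrees.

open import Level using (0ℓ)
open import Algebra.Bundles using (CommutativeRing; RawRing; Semiring)
import Algebra.Construct.Pointwise as Pointwise
open import Data.Nat using (ℕ; zero; suc; _∸_; _<_; _≤_; z≤n; s≤s; NonZero; pred; _≟_; _≤?_; _<?_)
import Data.Nat.Properties as ℕ
open import Data.Product using (_,_; _×_; ∃-syntax; proj₁; proj₂)
open import Relation.Nullary using (¬_; yes; no)
import Relation.Binary.PropositionalEquality as ≡
open import Relation.Nullary.Decidable using (_×-dec_)

-- Power series over a commutative ring

module PowerSeries {c ℓ} (R : CommutativeRing c ℓ) where

  open import Data.Nat using () renaming (_+_ to _+ℕ_)

  open CommutativeRing R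
  open import Algebra.Properties.CommutativeSemigroup +-commutativeSemigroup using (interchange)
  open import Relation.Binary.Reasoning.Setoid setoid

  ∑ : ℕ → (ℕ → Carrier) → Carrier
  ∑ zero    f = 0#
  ∑ (suc n) f = ∑ n f + f n

  ∑-cong : ∀ n {f g : ℕ → Carrier} → (∀ i → i < n → f i ≈ g i) → ∑ n f ≈ ∑ n g
  ∑-cong zero    f≈g = refl
  ∑-cong (suc n) f≈g = +-cong (∑-cong n (λ i i<n → f≈g i (ℕ.m<n⇒m<1+n i<n))) (f≈g n ℕ.≤-refl)

  ∑-zero : ∀ n {f : ℕ → Carrier} → (∀ i → i < n → f i ≈ 0#) → ∑ n f ≈ 0#
  ∑-zero zero    f≈0 = refl
  ∑-zero (suc n) f≈0 = trans (+-cong (∑-zero n (λ i i<n → f≈0 i (ℕ.m<n⇒m<1+n i<n))) (f≈0 n ℕ.≤-refl)) (+-identityˡ 0#)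

  ∑-single : ∀ n k {f : ℕ → Carrier} → k < n → (∀ i → i < n → ¬ i ≡.≡ k → f i ≈ 0#) → ∑ n f ≈ f k
  ∑-single (suc n) k k<1+n f≈0 with k ≟ n
  ... | yes ≡.refl = trans (+-cong (∑-zero n (λ i i<n → f≈0 i (ℕ.m<n⇒m<1+n i<n) (ℕ.<⇒≢ i<n))) refl) (+-identityˡ _)
  ... | no k≢n = trans (+-cong (∑-single n k (ℕ.≤∧≢⇒< (ℕ.≤-pred k<1+n) k≢n) (λ i i<n → f≈0 i (ℕ.m<n⇒m<1+n i<n)))
                               (f≈0 n ℕ.≤-refl (λ n≡k → k≢n (≡.sym n≡k))))
                       (+-identityʳ _)

  ∑-distrib-+ : ∀ n (f g : ℕ → Carrier) → ∑ n (λ i → f i + g i) ≈ ∑ n f + ∑ n g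
  ∑-distrib-+ zero    f g = sym (+-identityˡ 0#)
  ∑-distrib-+ (suc n) f g = trans (+-congʳ (∑-distrib-+ n f g)) (interchange _ _ _ _)

  ∑-distribˡ : ∀ n a (f : ℕ → Carrier) → a * ∑ n f ≈ ∑ n (λ i → a * f i)
  ∑-distribˡ zero    a f = zeroʳ a
  ∑-distribˡ (suc n) a f = trans (distribˡ a _ _) (+-congʳ (∑-distribˡ n a f))

  ∑-distribʳ : ∀ n a (f : ℕ → Carrier) → ∑ n f * a ≈ ∑ n (λ i → f i * a)
  ∑-distribʳ zero    a f = zeroˡ a
  ∑-distribʳ (suc n) a f = trans (distribʳ a _ _) (+-congʳ (∑-distribʳ n a f))

  ∑-head : ∀ n (f : ℕ → Carrier) → ∑ (suc n) f ≈ f 0 + ∑ n (λ i → f (suc i))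
  ∑-head zero    f = trans (+-identityˡ _) (sym (+-identityʳ _))
  ∑-head (suc n) f = trans (+-congʳ (∑-head n f)) (+-assoc _ _ _)

  ∑-reverse : ∀ n (f : ℕ → Carrier) → ∑ (suc n) f ≈ ∑ (suc n) (λ i → f (n ∸ i))
  ∑-reverse zero    f = refl
  ∑-reverse (suc n) f = begin
    ∑ (suc n) f + f (suc n)                  ≈⟨ +-comm _ _ ⟩
    f (suc n) + ∑ (suc n) f                  ≈⟨ +-congˡ (∑-reverse n f) ⟩
    f (suc n) + ∑ (suc n) (λ i → f (n ∸ i))  ≈⟨ ∑-head (suc n) (λ i → f (suc n ∸ i)) ⟨
    ∑ (suc (suc n)) (λ i → f (suc n ∸ i))    ∎

  ∑-triangle : ∀ n (V : ℕ → ℕ → Carrier) →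
    ∑ (suc n) (λ a → ∑ (suc a) (V a)) ≈ ∑ (suc n) (λ b → ∑ (suc (n ∸ b)) (λ c → V (b +ℕ c) b))
  ∑-triangle zero    V = refl
  ∑-triangle (suc n) V = begin
    ∑ (suc n) (λ a → ∑ (suc a) (V a)) + (∑ (suc n) (V (suc n)) + V (suc n) (suc n))
      ≈⟨ +-congʳ (∑-triangle n V) ⟩
    ∑ (suc n) (λ b → ∑ (suc (n ∸ b)) (λ c → V (b +ℕ c) b)) + (∑ (suc n) (V (suc n)) + V (suc n) (suc n))
      ≈⟨ +-assoc _ _ _ ⟨
    (∑ (suc n) (λ b → ∑ (suc (n ∸ b)) (λ c → V (b +ℕ c) b)) + ∑ (suc n) (V (suc n))) + V (suc n) (suc n)
      ≈⟨ +-cong (∑-distrib-+ (suc n) _ _) last ⟨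
    ∑ (suc n) (λ b → ∑ (suc (n ∸ b)) (λ c → V (b +ℕ c) b) + V (suc n) b) + ∑ (suc (suc n ∸ suc n)) (λ c → V (suc n +ℕ c) (suc n))
      ≈⟨ +-congʳ (∑-cong (suc n) column) ⟩
    ∑ (suc n) (λ b → ∑ (suc (suc n ∸ b)) (λ c → V (b +ℕ c) b)) + ∑ (suc (suc n ∸ suc n)) (λ c → V (suc n +ℕ c) (suc n)) ∎
    where
    last : ∑ (suc (suc n ∸ suc n)) (λ c → V (suc n +ℕ c) (suc n)) ≈ V (suc n) (suc n)
    last = begin
      ∑ (suc (suc n ∸ suc n)) (λ c → V (suc n +ℕ c) (suc n))
        ≡⟨ ≡.cong (λ k → ∑ (suc k) (λ c → V (suc n +ℕ c) (suc n))) (ℕ.n∸n≡0 n) ⟩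
      0# + V (suc n +ℕ 0) (suc n)
        ≈⟨ +-identityˡ _ ⟩
      V (suc n +ℕ 0) (suc n)
        ≡⟨ ≡.cong (λ k → V k (suc n)) (ℕ.+-identityʳ (suc n)) ⟩
      V (suc n) (suc n)                                      ∎
    column : ∀ b → b < suc n →
      ∑ (suc (n ∸ b)) (λ c → V (b +ℕ c) b) + V (suc n) b ≈ ∑ (suc (suc n ∸ b)) (λ c → V (b +ℕ c) b)
    column b (s≤s b≤n) = begin
      ∑ (suc (n ∸ b)) (λ c → V (b +ℕ c) b) + V (suc n) b
        ≡⟨ ≡.cong (λ k → ∑ (suc (n ∸ b)) (λ c → V (b +ℕ c) b) + V k b) b+[1+n∸b]≡1+n ⟨
      ∑ (suc (n ∸ b)) (λ c → V (b +ℕ c) b) + V (b +ℕ suc (n ∸ b)) b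
        ≡⟨ ≡.cong (λ k → ∑ (suc k) (λ c → V (b +ℕ c) b)) (ℕ.+-∸-assoc 1 b≤n) ⟨
      ∑ (suc (suc n ∸ b)) (λ c → V (b +ℕ c) b)                          ∎
      where
      b+[1+n∸b]≡1+n : b +ℕ suc (n ∸ b) ≡.≡ suc n
      b+[1+n∸b]≡1+n = ≡.trans (ℕ.+-suc b (n ∸ b)) (≡.cong suc (ℕ.m+[n∸m]≡n b≤n))

  Series : Set c
  Series = ℕ → Carrier

  infix 4 _≋_
  _≋_ : Series → Series → Set ℓ
  F ≋ G = ∀ n → F n ≈ G n

  infixl 6 _⊞_
  _⊞_ : Series → Series → Series
  (F ⊞ G) n = F n + G n

  ⊟_ : Series → Series
  (⊟ F) n = - F n

  infixl 7 _⋆_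
  _⋆_ : Series → Series → Series
  (F ⋆ G) n = ∑ (suc n) (λ a → F a * G (n ∸ a))

  𝟙 : Series
  𝟙 zero    = 1#
  𝟙 (suc _) = 0#

  ⋆-cong : ∀ {F F′ G G′} → F ≋ F′ → G ≋ G′ → F ⋆ G ≋ F′ ⋆ G′
  ⋆-cong F≋F′ G≋G′ n = ∑-cong (suc n) (λ a _ → *-cong (F≋F′ a) (G≋G′ (n ∸ a)))

  ⋆-comm : ∀ F G → F ⋆ G ≋ G ⋆ F
  ⋆-comm F G n = trans (∑-reverse n _) (∑-cong (suc n) (λ a a≤n →
    trans (*-congˡ (reflexive (≡.cong G (ℕ.m∸[m∸n]≡n (ℕ.≤-pred a≤n))))) (*-comm _ _)))

  ⋆-assoc : ∀ F G H → (F ⋆ G) ⋆ H ≋ F ⋆ (G ⋆ H)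
  ⋆-assoc F G H n = begin
    ∑ (suc n) (λ a → ∑ (suc a) (λ b → F b * G (a ∸ b)) * H (n ∸ a))
      ≈⟨ ∑-cong (suc n) (λ a _ → ∑-distribʳ (suc a) _ _) ⟩
    ∑ (suc n) (λ a → ∑ (suc a) (λ b → F b * G (a ∸ b) * H (n ∸ a)))
      ≈⟨ ∑-triangle n (λ a b → F b * G (a ∸ b) * H (n ∸ a)) ⟩
    ∑ (suc n) (λ b → ∑ (suc (n ∸ b)) (λ c → F b * G ((b +ℕ c) ∸ b) * H (n ∸ (b +ℕ c))))
      ≈⟨ ∑-cong (suc n) (λ b _ → ∑-cong (suc (n ∸ b)) (λ c _ → trans
           (reflexive (≡.cong₂ (λ u v → F b * G u * H v) (ℕ.m+n∸m≡n b c) (≡.sym (ℕ.∸-+-assoc n b c))))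
           (*-assoc _ _ _))) ⟩
    ∑ (suc n) (λ b → ∑ (suc (n ∸ b)) (λ c → F b * (G c * H ((n ∸ b) ∸ c))))
      ≈⟨ ∑-cong (suc n) (λ b _ → ∑-distribˡ (suc (n ∸ b)) _ _) ⟨
    ∑ (suc n) (λ b → F b * ∑ (suc (n ∸ b)) (λ c → G c * H ((n ∸ b) ∸ c))) ∎

  ⋆-identityˡ : ∀ F → 𝟙 ⋆ F ≋ F
  ⋆-identityˡ F n = begin
    ∑ (suc n) (λ a → 𝟙 a * F (n ∸ a))           ≈⟨ ∑-head n _ ⟩
    1# * F n + ∑ n (λ a → 0# * F (n ∸ suc a))   ≈⟨ +-cong (*-identityˡ _) (∑-zero n (λ a _ → zeroˡ _)) ⟩
    F n + 0#                                    ≈⟨ +-identityʳ _ ⟩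
    F n                                         ∎

  ⋆-distribʳ : ∀ F G H → (G ⊞ H) ⋆ F ≋ G ⋆ F ⊞ H ⋆ F
  ⋆-distribʳ F G H n = trans (∑-cong (suc n) (λ a _ → distribʳ _ _ _)) (∑-distrib-+ (suc n) _ _)

  seriesRing : CommutativeRing c ℓ
  seriesRing = record
    { Carrier = Series ; _≈_ = _≋_ ; _+_ = _⊞_ ; _*_ = _⋆_ ; -_ = ⊟_ ; 0# = λ _ → 0# ; 1# = 𝟙
    ; isCommutativeRing = record
      { isRing = record
        { +-isAbelianGroup = Pointwise.isAbelianGroup ℕ +-isAbelianGroup
        ; *-cong = ⋆-cong
        ; *-assoc = ⋆-assoc
        ; *-identity = ⋆-identityˡ , λ F → trans′ (⋆-comm F 𝟙) (⋆-identityˡ F)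
        ; distrib = (λ F G H → trans′ (⋆-comm F (G ⊞ H)) (trans′ (⋆-distribʳ F G H) (λ n → +-cong (⋆-comm G F n) (⋆-comm H F n))))
                  , ⋆-distribʳ }
      ; *-comm = ⋆-comm } }
    where
    trans′ : ∀ {F G H} → F ≋ G → G ≋ H → F ≋ H
    trans′ F≋G G≋H n = trans (F≋G n) (G≋H n)

open import Algebra.Structures using (IsCommutativeRing)
open import Algebra.Morphism.Structures using (IsRingMonomorphism)
import Algebra.Morphism.RingMonomorphism as RingMonomorphism
import Algebra.Properties.Ring as RingProperties
import Algebra.Properties.AbelianGroup as AbelianGroupProperties
open import Data.Nat using (_+_; _*_; _%_; _/_)
open import Data.Nat.Base using (nonTrivial⇒≢1)
open import Data.Nat.DivMod using (%-distribˡ-+; %-distribˡ-*; %-remove-+ˡ; m≡m%n+[m/n]*n; [m+kn]%n≡m%n; m*n%n≡0)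
open import Data.Nat.Divisibility using (_∣_; divides; m%n≡0⇒n∣m; n∣m⇒m%n≡0; n∣m*n; ∣1⇒≡1)
open import Data.Nat.Primality using (Prime; prime⇒nonZero; prime⇒nonTrivial; prime⇒irreducible)
open import Data.Nat.Coprimality using (Coprime; coprime-Bézout)
open import Data.Nat.GCD using (module Bézout)
open import Data.Nat.Combinatorics using (_C_; nCn≡1; nCk+nC[k+1]≡[n+1]C[k+1])
open import Data.Sum using (_⊎_; inj₁; inj₂)
open import Data.Empty using (⊥-elim)
open import Function using (id; _∘_)
open import Function.Bundles using (_⇔_; mk⇔; Equivalence)
open import Relation.Binary.PropositionalEquality
open import Relation.Binary.Structures using (IsEquivalence)
open import Algebra.Properties.CommutativeSemigroup ℕ.+-commutativeSemigroup using () renaming (interchange to +-interchange)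
open import Defs renaming (_≈_ to _≈ₚ_; _⊕_ to infixl 6 _⊕_; _⊗_ to infixl 7 _⊗_; _^P_ to infixr 8 _^P_)

-- Arithmetic modulo p

module ModularArithmetic (p : ℕ) .{{_ : NonZero p}} where

  infix 4 _≃_
  record _≃_ (a b : ℕ) : Set where
    constructor mod-≡
    field %-≡ : a % p ≡ b % p
  open _≃_ public

  ≃-reflexive : ∀ {a b} → a ≡ b → a ≃ b
  ≃-reflexive a≡b = mod-≡ (cong (_% p) a≡b)

  private
    ∣∸⇒%≡ : ∀ {a b} → a ≤ b → p ∣ b ∸ a → a % p ≡ b % p
    ∣∸⇒%≡ {a} {b} a≤b p∣b∸a = begin
      a % p           ≡⟨ %-remove-+ˡ a p∣b∸a ⟨
      (b ∸ a + a) % p ≡⟨ cong (_% p) (ℕ.m∸n+n≡m a≤b) ⟩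
      b % p           ∎
      where open ≡-Reasoning

    %≡⇒∣∸ : ∀ a b → a % p ≡ b % p → p ∣ b ∸ a
    %≡⇒∣∸ a b a%≡b% = divides (b / p ∸ a / p) (begin
      b ∸ a                                         ≡⟨ cong₂ _∸_ (m≡m%n+[m/n]*n b p) (m≡m%n+[m/n]*n a p) ⟩
      (b % p + b / p * p) ∸ (a % p + a / p * p)     ≡⟨ cong (λ r → (b % p + b / p * p) ∸ (r + a / p * p)) a%≡b% ⟩
      (b % p + b / p * p) ∸ (b % p + a / p * p)     ≡⟨ ℕ.[m+n]∸[m+o]≡n∸o (b % p) _ _ ⟩
      b / p * p ∸ a / p * p                         ≡⟨ ℕ.*-distribʳ-∸ p (b / p) (a / p) ⟨
      (b / p ∸ a / p) * p                           ∎)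
      where open ≡-Reasoning

  ≡ₚ⇒≃ : ∀ {a b} → _≡ₚ_ p a b → a ≃ b
  ≡ₚ⇒≃ {a} {b} p∣∣a-b∣ with ℕ.≤-total a b
  ... | inj₁ a≤b = mod-≡ (∣∸⇒%≡ a≤b (subst (p ∣_) (ℕ.m≤n⇒∣m-n∣≡n∸m a≤b) p∣∣a-b∣))
  ... | inj₂ b≤a = mod-≡ (sym (∣∸⇒%≡ b≤a (subst (p ∣_) (ℕ.m≤n⇒∣n-m∣≡n∸m b≤a) p∣∣a-b∣)))

  ≃⇒≡ₚ : ∀ {a b} → a ≃ b → _≡ₚ_ p a b
  ≃⇒≡ₚ {a} {b} (mod-≡ a%≡b%) with ℕ.≤-total a b
  ... | inj₁ a≤b = subst (p ∣_) (sym (ℕ.m≤n⇒∣m-n∣≡n∸m a≤b)) (%≡⇒∣∸ a b a%≡b%)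
  ... | inj₂ b≤a = subst (p ∣_) (sym (ℕ.m≤n⇒∣n-m∣≡n∸m b≤a)) (%≡⇒∣∸ b a (sym a%≡b%))

  private
    -‿inverseˡ : ∀ a → pred p * a + a ≃ 0
    -‿inverseˡ a = mod-≡ (begin
      (pred p * a + a) % p ≡⟨ cong (_% p) (ℕ.+-comm (pred p * a) a) ⟩
      (suc (pred p) * a) % p ≡⟨ cong (λ q → (q * a) % p) (ℕ.suc-pred p) ⟩
      (p * a) % p ≡⟨ cong (_% p) (ℕ.*-comm p a) ⟩
      (0 + a * p) % p ≡⟨ [m+kn]%n≡m%n 0 a p ⟩
      0 % p ∎)
      where open ≡-Reasoning

  ℤ/pℤ : CommutativeRing 0ℓ 0ℓ
  ℤ/pℤ = record
    { Carrier = ℕ ; _≈_ = _≃_ ; _+_ = _+_ ; _*_ = _*_ ; -_ = pred p *_ ; 0# = 0 ; 1# = 1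
    ; isCommutativeRing = record
      { isRing = record
        { +-isAbelianGroup = record
          { isGroup = record
            { isMonoid = record
              { isSemigroup = record
                { isMagma = record { isEquivalence = ≃-isEquivalence ; ∙-cong = +-cong }
                ; assoc = λ a b c → ≃-reflexive (ℕ.+-assoc a b c) }
              ; identity = (λ a → ≃-reflexive (ℕ.+-identityˡ a)) , (λ a → ≃-reflexive (ℕ.+-identityʳ a)) }
            ; inverse = -‿inverseˡ , (λ a → ≃-trans (≃-reflexive (ℕ.+-comm a _)) (-‿inverseˡ a))
            ; ⁻¹-cong = *-cong (≃-reflexive {pred p} refl) }
          ; comm = λ a b → ≃-reflexive (ℕ.+-comm a b) }
        ; *-cong = *-cong
        ; *-assoc = λ a b c → ≃-reflexive (ℕ.*-assoc a b c)
        ; *-identity = (λ a → ≃-reflexive (ℕ.*-identityˡ a)) , (λ a → ≃-reflexive (ℕ.*-identityʳ a))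
        ; distrib = (λ a b c → ≃-reflexive (ℕ.*-distribˡ-+ a b c)) , (λ a b c → ≃-reflexive (ℕ.*-distribʳ-+ a b c)) }
      ; *-comm = λ a b → ≃-reflexive (ℕ.*-comm a b) } }
    where
    ≃-trans : ∀ {a b c} → a ≃ b → b ≃ c → a ≃ c
    ≃-trans (mod-≡ e) (mod-≡ e′) = mod-≡ (trans e e′)
    ≃-isEquivalence : IsEquivalence _≃_
    ≃-isEquivalence = record { refl = mod-≡ refl ; sym = λ (mod-≡ e) → mod-≡ (sym e) ; trans = ≃-trans }
    +-cong : ∀ {a b c d} → a ≃ b → c ≃ d → a + c ≃ b + d
    +-cong {a} {b} {c} {d} (mod-≡ e) (mod-≡ e′) = mod-≡ (begin
      (a + c) % p         ≡⟨ %-distribˡ-+ a c p ⟩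
      (a % p + c % p) % p ≡⟨ cong₂ (λ x y → (x + y) % p) e e′ ⟩
      (b % p + d % p) % p ≡⟨ %-distribˡ-+ b d p ⟨
      (b + d) % p         ∎)
      where open ≡-Reasoning
    *-cong : ∀ {a b c d} → a ≃ b → c ≃ d → a * c ≃ b * d
    *-cong {a} {b} {c} {d} (mod-≡ e) (mod-≡ e′) = mod-≡ (begin
      (a * c) % p             ≡⟨ %-distribˡ-* a c p ⟩
      ((a % p) * (c % p)) % p ≡⟨ cong₂ (λ x y → (x * y) % p) e e′ ⟩
      ((b % p) * (d % p)) % p ≡⟨ %-distribˡ-* b d p ⟨
      (b * d) % p             ∎)
      where open ≡-Reasoning

  module ℤₚ = CommutativeRing ℤ/pℤ
  open ℤₚ using (-_)

  *-zeroʳ-≃ : ∀ a {b} → b ≃ 0 → a * b ≃ 0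
  *-zeroʳ-≃ a b≃0 = ℤₚ.trans (ℤₚ.*-congˡ {a} b≃0) (ℤₚ.zeroʳ a)

  *-zeroˡ-≃ : ∀ {a} b → a ≃ 0 → a * b ≃ 0
  *-zeroˡ-≃ b a≃0 = ℤₚ.trans (ℤₚ.*-congʳ {b} a≃0) (ℤₚ.zeroˡ b)

  ≃0⇔∣ : ∀ {a} → a ≃ 0 ⇔ p ∣ a
  ≃0⇔∣ {a} = mk⇔ (λ (mod-≡ a%≡0%) → m%n≡0⇒n∣m a p (trans a%≡0% (m*n%n≡0 0 p)))
                 (λ p∣a → mod-≡ (trans (n∣m⇒m%n≡0 a p p∣a) (sym (m*n%n≡0 0 p))))

  module _ (p-prime : Prime p) where

    1≄0 : ¬ 1 ≃ 0
    1≄0 1≃0 = nonTrivial⇒≢1 {{prime⇒nonTrivial p-prime}} (∣1⇒≡1 (Equivalence.to ≃0⇔∣ 1≃0))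

    inverse : ∀ {c} → ¬ p ∣ c → ∃[ c⁻¹ ] c⁻¹ * c ≃ 1
    inverse {c} p∤c with coprime-Bézout p⊥c
      where
      p⊥c : Coprime p c
      p⊥c (d∣p , d∣c) with prime⇒irreducible p-prime d∣p
      ... | inj₁ d≡1    = d≡1
      ... | inj₂ refl   = ⊥-elim (p∤c d∣c)
    ... | Bézout.-+ x y 1+xp≡yc = y , ℤₚ.sym (begin
      1         ≈⟨ ℤₚ.+-identityʳ 1 ⟨
      1 + 0     ≈⟨ ℤₚ.+-congˡ (Equivalence.from ≃0⇔∣ (n∣m*n x)) ⟨
      1 + x * p ≡⟨ 1+xp≡yc ⟩
      y * c     ∎)
      where open import Relation.Binary.Reasoning.Setoid ℤₚ.setoid
    ... | Bézout.+- x y 1+yc≡xp = - y , (begin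
      - y * c               ≡⟨ ℕ.*-assoc (pred p) y c ⟩
      - (y * c)             ≈⟨ ℤₚ.+-identityˡ _ ⟨
      0 + - (y * c)         ≈⟨ ℤₚ.+-congʳ (Equivalence.from ≃0⇔∣ (n∣m*n x)) ⟨
      x * p + - (y * c)     ≡⟨ cong (_+ - (y * c)) 1+yc≡xp ⟨
      1 + y * c + - (y * c) ≈⟨ ℤₚ.+-assoc 1 (y * c) _ ⟩
      1 + (y * c + - (y * c)) ≈⟨ ℤₚ.+-congˡ (ℤₚ.-‿inverseʳ (y * c)) ⟩
      1 + 0                 ≈⟨ ℤₚ.+-identityʳ 1 ⟩
      1                     ∎)
      where open import Relation.Binary.Reasoning.Setoid ℤₚ.setoid

    *-cancelˡ-≃0 : ∀ {c a} → ¬ p ∣ c → c * a ≃ 0 → a ≃ 0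
    *-cancelˡ-≃0 {c} {a} p∤c ca≃0 with inverse p∤c
    ... | c⁻¹ , c⁻¹c≃1 = begin
      a             ≈⟨ ℤₚ.*-identityˡ a ⟨
      1 * a         ≈⟨ ℤₚ.*-congʳ c⁻¹c≃1 ⟨
      c⁻¹ * c * a   ≈⟨ ℤₚ.*-assoc c⁻¹ c a ⟩
      c⁻¹ * (c * a) ≈⟨ *-zeroʳ-≃ c⁻¹ ca≃0 ⟩
      0             ∎
      where open import Relation.Binary.Reasoning.Setoid ℤₚ.setoid

-- Coefficient functions

δ : ℕ → ℕ → ℕ
δ zero    zero    = 1
δ zero    (suc _) = 0
δ (suc _) zero    = 0
δ (suc a) (suc i) = δ a i

δ-refl : ∀ a → δ a a ≡ 1
δ-refl zero    = refl
δ-refl (suc a) = δ-refl a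

δ-≢ : ∀ {a i} → a ≢ i → δ a i ≡ 0
δ-≢ {zero}  {zero}  a≢i = ⊥-elim (a≢i refl)
δ-≢ {zero}  {suc i} a≢i = refl
δ-≢ {suc a} {zero}  a≢i = refl
δ-≢ {suc a} {suc i} a≢i = δ-≢ (λ a≡i → a≢i (cong suc a≡i))

δ-+ : ∀ a {b c} → δ (a + b) (a + c) ≡ δ b c
δ-+ zero    = refl
δ-+ (suc a) = δ-+ a

δ-∸ : ∀ a a′ {i} → a ≤ i → δ a′ (i ∸ a) ≡ δ (a + a′) i
δ-∸ zero    a′ _         = refl
δ-∸ (suc a) a′ (s≤s a≤i) = δ-∸ a a′ a≤i

δ-*-cong : ∀ {a i} x y → (a ≡ i → x ≡ y) → δ a i * x ≡ δ a i * y
δ-*-cong {a} {i} x y x≡y with a ≟ i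
... | yes a≡i = cong (δ a i *_) (x≡y a≡i)
... | no  a≢i = trans (cong (_* x) (δ-≢ a≢i)) (sym (cong (_* y) (δ-≢ a≢i)))

monomial : ℕ → ℕ → ℕ → Coef
monomial c a b i k = c * (δ a i * δ b k)

monomial-on : ∀ c a b → monomial c a b a b ≡ c
monomial-on c a b = trans (cong₂ (λ u v → c * (u * v)) (δ-refl a) (δ-refl b)) (ℕ.*-identityʳ c)

monomial-off : ∀ c a b {i k} → ¬ (i ≡ a × k ≡ b) → monomial c a b i k ≡ 0
monomial-off c a b {i} {k} ¬on with a ≟ i | b ≟ k
... | yes refl | yes refl = ⊥-elim (¬on (refl , refl))
... | no a≢i   | _        = trans (cong (λ u → c * (u * δ b k)) (δ-≢ a≢i)) (ℕ.*-zeroʳ c)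
... | yes _    | no b≢k   = trans (cong (λ u → c * (δ a i * u)) (δ-≢ b≢k)) (trans (cong (c *_) (ℕ.*-zeroʳ (δ a i))) (ℕ.*-zeroʳ c))

binomial : ℕ → Coef
binomial m i k = δ m (i + k) * (m C i)

shift : ℕ → ℕ → Coef → Coef
shift a b f i k = f (a + i) (b + k)

xAbove : ℕ → Coef → Coef
xAbove t P i k with t <? i
... | yes _ = P i k
... | no  _ = 0

xUpTo : ℕ → Coef → Coef
xUpTo t P i k with t <? i
... | yes _ = 0
... | no  _ = P i k

∸+∸+[+]≡+ : ∀ {a b i k} → a ≤ i → b ≤ k → (i ∸ a) + (k ∸ b) + (a + b) ≡ i + k
∸+∸+[+]≡+ {a} {b} {i} {k} a≤i b≤k = trans (+-interchange (i ∸ a) (k ∸ b) a b) (cong₂ _+_ (ℕ.m∸n+n≡m a≤i) (ℕ.m∸n+n≡m b≤k))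

xAbove-yes : ∀ {t i} → t < i → ∀ P k → xAbove t P i k ≡ P i k
xAbove-yes {t} {i} t<i P k with t <? i
... | yes _   = refl
... | no t≮i = ⊥-elim (t≮i t<i)

xAbove-no : ∀ {t i} → ¬ t < i → ∀ P k → xAbove t P i k ≡ 0
xAbove-no {t} {i} t≮i P k with t <? i
... | yes t<i = ⊥-elim (t≮i t<i)
... | no _    = refl

+-mono-≤-≢-< : ∀ {a b i k} → a ≤ i → b ≤ k → ¬ (a ≡ i × b ≡ k) → a + b < i + k
+-mono-≤-≢-< {a} {b} {i} {k} a≤i b≤k ¬on with a ≟ i | b ≟ k
... | yes a≡i | yes b≡k = ⊥-elim (¬on (a≡i , b≡k))
... | no a≢i  | _       = ℕ.+-mono-<-≤ (ℕ.≤∧≢⇒< a≤i a≢i) b≤k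
... | yes _   | no b≢k  = ℕ.+-mono-≤-< a≤i (ℕ.≤∧≢⇒< b≤k b≢k)

IsPoly-shift : ∀ a b {f} → IsPoly f → IsPoly (shift a b f)
IsPoly-shift a b (N , f≡0) = N , λ i k N≤i+k → f≡0 (a + i) (b + k)
  (ℕ.≤-trans N≤i+k (ℕ.+-mono-≤ (ℕ.m≤n+m i a) (ℕ.m≤n+m k b)))

IsPoly-⊕ : ∀ {f g} → IsPoly f → IsPoly g → IsPoly (f ⊕ g)
IsPoly-⊕ (N , f≡0) (M , g≡0) = N + M , λ i k N+M≤i+k →
  cong₂ _+_ (f≡0 i k (ℕ.≤-trans (ℕ.m≤m+n N M) N+M≤i+k)) (g≡0 i k (ℕ.≤-trans (ℕ.m≤n+m M N) N+M≤i+k))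

IsPoly-scale : ∀ c {f} → IsPoly f → IsPoly (λ i k → c * f i k)
IsPoly-scale c (N , f≡0) = N , λ i k N≤i+k → trans (cong (c *_) (f≡0 i k N≤i+k)) (ℕ.*-zeroʳ c)

IsPoly-homogeneous : ∀ d {f} → (∀ i k → i + k ≢ d → f i k ≡ 0) → IsPoly f
IsPoly-homogeneous d f≡0 = suc d , λ i k d<i+k → f≡0 i k (λ i+k≡d → ℕ.<-irrefl (sym i+k≡d) d<i+k)

IsPoly-monomial : ∀ c a b → IsPoly (monomial c a b)
IsPoly-monomial c a b = IsPoly-homogeneous (a + b) λ i k i+k≢a+b →
  monomial-off c a b λ (i≡a , k≡b) → i+k≢a+b (cong₂ _+_ i≡a k≡b)

X-off : ∀ i k → i + k ≢ 1 → X i k ≡ 0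
X-off zero          k       _   = refl
X-off (suc zero)    zero    1≢1 = ⊥-elim (1≢1 refl)
X-off (suc zero)    (suc k) _   = refl
X-off (suc (suc i)) k       _   = refl

Y-off : ∀ i k → i + k ≢ 1 → Y i k ≡ 0
Y-off zero    zero          _   = refl
Y-off zero    (suc zero)    1≢1 = ⊥-elim (1≢1 refl)
Y-off zero    (suc (suc k)) _   = refl
Y-off (suc i) k             _   = refl

IsPoly-X : IsPoly X
IsPoly-X = IsPoly-homogeneous 1 X-off

IsPoly-Y : IsPoly Y
IsPoly-Y = IsPoly-homogeneous 1 Y-off

IsPoly-zeroP : IsPoly zeroP
IsPoly-zeroP = 0 , λ _ _ _ → refl

IsPoly-oneP : IsPoly oneP
IsPoly-oneP = IsPoly-homogeneous 0 λ
  { zero    zero    0≢0 → ⊥-elim (0≢0 refl)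
  ; zero    (suc k) _ → refl
  ; (suc i) k       _ → refl }

IsPoly-xAbove : ∀ t {P} → IsPoly P → IsPoly (xAbove t P)
IsPoly-xAbove t {P} (N , P≡0) = N , vanish
  where
  vanish : ∀ i k → N ≤ i + k → xAbove t P i k ≡ 0
  vanish i k N≤i+k with t <? i
  ... | yes _ = P≡0 i k N≤i+k
  ... | no  _ = refl

IsPoly-xUpTo : ∀ t {P} → IsPoly P → IsPoly (xUpTo t P)
IsPoly-xUpTo t {P} (N , P≡0) = N , vanish
  where
  vanish : ∀ i k → N ≤ i + k → xUpTo t P i k ≡ 0
  vanish i k N≤i+k with t <? i
  ... | yes _ = refl
  ... | no  _ = P≡0 i k N≤i+k

private
  Σ<-zero : ∀ n {f : ℕ → ℕ} → (∀ i → i < n → f i ≡ 0) → Σ< n f ≡ 0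
  Σ<-zero zero    f≡0 = refl
  Σ<-zero (suc n) f≡0 = cong₂ _+_ (Σ<-zero n (λ i i<n → f≡0 i (ℕ.m<n⇒m<1+n i<n))) (f≡0 n ℕ.≤-refl)

IsPoly-⊗ : ∀ {f g} → IsPoly f → IsPoly g → IsPoly (f ⊗ g)
IsPoly-⊗ {f} {g} (N , f≡0) (M , g≡0) = N + M , λ i k N+M≤i+k →
  Σ<-zero (suc i) λ a a≤i → Σ<-zero (suc k) λ b b≤k → term≡0 N+M≤i+k (ℕ.≤-pred a≤i) (ℕ.≤-pred b≤k)
  where
  term≡0 : ∀ {i k a b} → N + M ≤ i + k → a ≤ i → b ≤ k → f a b * g (i ∸ a) (k ∸ b) ≡ 0
  term≡0 {i} {k} {a} {b} N+M≤i+k a≤i b≤k with N ≤? a + b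
  ... | yes N≤a+b = cong (_* g (i ∸ a) (k ∸ b)) (f≡0 a b N≤a+b)
  ... | no  N≰a+b = trans (cong (f a b *_) (g≡0 (i ∸ a) (k ∸ b) M≤rest)) (ℕ.*-zeroʳ (f a b))
    where
    M≤rest : M ≤ (i ∸ a) + (k ∸ b)
    M≤rest = ℕ.+-cancelʳ-≤ (a + b) M _ (ℕ.≤-trans (ℕ.+-monoʳ-≤ M (ℕ.<⇒≤ (ℕ.≰⇒> N≰a+b)))
               (ℕ.≤-trans (ℕ.≤-reflexive (ℕ.+-comm M N)) (ℕ.≤-trans N+M≤i+k (ℕ.≤-reflexive (sym (∸+∸+[+]≡+ a≤i b≤k))))))

-- The polynomial ring 𝔽ₚ[x,y]

module PolynomialRing (p : ℕ) .{{_ : NonZero p}} where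

  open ModularArithmetic p public

  private
    module S₁ = PowerSeries ℤ/pℤ
    module S₂ = PowerSeries S₁.seriesRing

  infix 4 _≐_
  record _≐_ (f g : Coef) : Set where
    constructor coeffwise
    field coeff : ∀ i k → f i k ≃ g i k
  open _≐_ public

  -- Opaque copies of the operations of Defs: unification then compares products structurally
  -- instead of unfolding them into sums of coefficients.
  opaque
    infixl 6 _⊞_
    _⊞_ : Coef → Coef → Coef
    _⊞_ = _⊕_

    infixl 7 _⊠_
    _⊠_ : Coef → Coef → Coef
    _⊠_ = _⊗_

    infix 8 ⊟_
    ⊟_ : Coef → Coef
    (⊟ f) i k = pred p * f i k

  private
    rawRing : RawRing 0ℓ 0ℓ
    rawRing = record { Carrier = Coef ; _≈_ = _≐_ ; _+_ = _⊞_ ; _*_ = _⊠_ ; -_ = ⊟_ ; 0# = zeroP ; 1# = oneP }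

  opaque
    unfolding _⊞_ _⊠_ ⊟_

    ⊞≡⊕ : ∀ f g → f ⊞ g ≡ f ⊕ g
    ⊞≡⊕ f g = refl

    ⊠≡⊗ : ∀ f g → f ⊠ g ≡ f ⊗ g
    ⊠≡⊗ f g = refl

    ⊟-coeff : ∀ f i k → (⊟ f) i k ≡ pred p * f i k
    ⊟-coeff f i k = refl

    private
      ∑₁≡Σ< : ∀ n f → S₁.∑ n f ≡ Σ< n f
      ∑₁≡Σ< zero    f = refl
      ∑₁≡Σ< (suc n) f = cong (_+ f n) (∑₁≡Σ< n f)

      Σ<≃∑ : ∀ n f → Σ< n f ≃ S₁.∑ n f
      Σ<≃∑ n f = ≃-reflexive (sym (∑₁≡Σ< n f))

      ∑₂≡Σ< : ∀ n H k → S₂.∑ n H k ≡ Σ< n (λ a → H a k)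
      ∑₂≡Σ< zero    H k = refl
      ∑₂≡Σ< (suc n) H k = cong (_+ H n k) (∑₂≡Σ< n H k)

      Σ<-cong : ∀ n {f g : ℕ → ℕ} → (∀ i → f i ≡ g i) → Σ< n f ≡ Σ< n g
      Σ<-cong zero    f≡g = refl
      Σ<-cong (suc n) f≡g = cong₂ _+_ (Σ<-cong n f≡g) (f≡g n)

      ⊠≋⋆ : ∀ f g → f ⊠ g S₂.≋ S₂._⋆_ f g
      ⊠≋⋆ f g i k = ≃-reflexive (begin
        Σ< (suc i) (λ a → Σ< (suc k) (λ b → f a b * g (i ∸ a) (k ∸ b))) ≡⟨ Σ<-cong (suc i) (λ a → sym (∑₁≡Σ< (suc k) _)) ⟩
        Σ< (suc i) (λ a → S₁._⋆_ (f a) (g (i ∸ a)) k)                   ≡⟨ sym (∑₂≡Σ< (suc i) _ k) ⟩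
        S₂._⋆_ f g i k                                                  ∎)
        where open ≡-Reasoning

      oneP≋𝟙 : oneP S₂.≋ S₂.𝟙
      oneP≋𝟙 zero    zero    = ≃-reflexive refl
      oneP≋𝟙 zero    (suc k) = ≃-reflexive refl
      oneP≋𝟙 (suc i) k       = ≃-reflexive refl

      -- The ring laws are inherited from ℤ/pℤ[[x]][[y]], into which coefficient functions embed as the identity.
      isRingMonomorphism : IsRingMonomorphism rawRing (CommutativeRing.rawRing S₂.seriesRing) id
      isRingMonomorphism = record
        { isRingHomomorphism = record
          { isSemiringHomomorphism = record
            { isNearSemiringHomomorphism = record
              { +-isMonoidHomomorphism = record
                { isMagmaHomomorphism = record
                  { isRelHomomorphism = record { cong = coeff }
                  ; homo = λ f g i k → ℤₚ.refl }
                ; ε-homo = λ i k → ℤₚ.refl }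
              ; *-homo = ⊠≋⋆ }
            ; 1#-homo = oneP≋𝟙 }
          ; -‿homo = λ f i k → ℤₚ.refl }
        ; injective = coeffwise }

    isCommutativeRing : IsCommutativeRing _≐_ _⊞_ _⊠_ ⊟_ zeroP oneP
    isCommutativeRing = RingMonomorphism.isCommutativeRing isRingMonomorphism (CommutativeRing.isCommutativeRing S₂.seriesRing)

    ⊠-coeff-zero : ∀ f g i k → (∀ a b → a ≤ i → b ≤ k → f a b * g (i ∸ a) (k ∸ b) ≃ 0) → (f ⊠ g) i k ≃ 0
    ⊠-coeff-zero f g i k terms≃0 =
      ℤₚ.trans (Σ<≃∑ (suc i) _) (S₁.∑-zero (suc i) λ a a≤i →
        ℤₚ.trans (Σ<≃∑ (suc k) _) (S₁.∑-zero (suc k) λ b b≤k → terms≃0 a b (ℕ.≤-pred a≤i) (ℕ.≤-pred b≤k)))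

    ⊠-coeff-single : ∀ f g i k a b → a ≤ i → b ≤ k →
      (∀ a′ b′ → a′ ≤ i → b′ ≤ k → ¬ (a′ ≡ a × b′ ≡ b) → f a′ b′ * g (i ∸ a′) (k ∸ b′) ≃ 0) →
      (f ⊠ g) i k ≃ f a b * g (i ∸ a) (k ∸ b)
    ⊠-coeff-single f g i k a b a≤i b≤k others≃0 =
      ℤₚ.trans (Σ<≃∑ (suc i) _) (ℤₚ.trans
        (S₁.∑-single (suc i) a (s≤s a≤i) λ a′ a′≤i a′≢a →
          ℤₚ.trans (Σ<≃∑ (suc k) _) (S₁.∑-zero (suc k) λ b′ b′≤k →
            others≃0 a′ b′ (ℕ.≤-pred a′≤i) (ℕ.≤-pred b′≤k) (λ (a′≡a , _) → a′≢a a′≡a)))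
        (ℤₚ.trans (Σ<≃∑ (suc k) _)
          (S₁.∑-single (suc k) b (s≤s b≤k) λ b′ b′≤k b′≢b →
            others≃0 a b′ a≤i (ℕ.≤-pred b′≤k) (λ (_ , b′≡b) → b′≢b b′≡b))))

  𝔽[x,y] : CommutativeRing 0ℓ 0ℓ
  𝔽[x,y] = record { isCommutativeRing = isCommutativeRing }

  module 𝔽[x,y] = CommutativeRing 𝔽[x,y]
  open 𝔽[x,y] public
    using ( +-cong; +-congˡ; +-congʳ; +-assoc; +-comm; +-identityˡ; +-identityʳ; -‿cong; -‿inverseˡ; -‿inverseʳ
          ; *-cong; *-congˡ; *-congʳ; *-assoc; *-comm; *-identityˡ; *-identityʳ; distribˡ; distribʳ; zeroˡ; zeroʳ )
  open import Algebra.Definitions.RawSemiring (Semiring.rawSemiring 𝔽[x,y].semiring) using (_^_) public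

  ≐⇒≈ₚ : ∀ {f g} → f ≐ g → _≈ₚ_ p f g
  ≐⇒≈ₚ f≐g i k = ≃⇒≡ₚ (coeff f≐g i k)

  ≈ₚ⇒≐ : ∀ {f g} → _≈ₚ_ p f g → f ≐ g
  ≈ₚ⇒≐ f≈g = coeffwise λ i k → ≡ₚ⇒≃ (f≈g i k)

  ^P≡^ : ∀ f n → f ^P n ≡ f ^ n
  ^P≡^ f zero    = refl
  ^P≡^ f (suc n) = trans (cong (f ⊗_) (^P≡^ f n)) (sym (⊠≡⊗ f (f ^ n)))

  ⊞-coeff : ∀ f g i k → (f ⊞ g) i k ≡ f i k + g i k
  ⊞-coeff f g i k = cong (λ h → h i k) (⊞≡⊕ f g)

  ⊞-coeff-≃ : ∀ f g i k → (f ⊞ g) i k ≃ f i k + g i k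
  ⊞-coeff-≃ f g i k = ≃-reflexive (⊞-coeff f g i k)

  monomial-⊠-coeff : ∀ c a b s {i k} → a ≤ i → b ≤ k → (monomial c a b ⊠ s) i k ≃ c * s (i ∸ a) (k ∸ b)
  monomial-⊠-coeff c a b s {i} {k} a≤i b≤k =
    ℤₚ.trans (⊠-coeff-single (monomial c a b) s i k a b a≤i b≤k λ a′ b′ _ _ ¬on →
                ≃-reflexive (cong (_* s (i ∸ a′) (k ∸ b′)) (monomial-off c a b ¬on)))
             (≃-reflexive (cong (_* s (i ∸ a) (k ∸ b)) (monomial-on c a b)))

  monomial-⊠-coeff-< : ∀ c a b s {i k} → i < a ⊎ k < b → (monomial c a b ⊠ s) i k ≃ 0
  monomial-⊠-coeff-< c a b s {i} {k} i<a⊎k<b = ⊠-coeff-zero (monomial c a b) s i k λ a′ b′ a′≤i b′≤k →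
    ≃-reflexive (cong (_* s (i ∸ a′) (k ∸ b′)) (monomial-off c a b (off a′≤i b′≤k i<a⊎k<b)))
    where
    off : ∀ {a′ b′} → a′ ≤ i → b′ ≤ k → i < a ⊎ k < b → ¬ (a′ ≡ a × b′ ≡ b)
    off a′≤i _ (inj₁ i<a) (refl , _) = ℕ.<⇒≱ i<a a′≤i
    off _ b′≤k (inj₂ k<b) (_ , refl) = ℕ.<⇒≱ k<b b′≤k

  monomial-⊠-monomial : ∀ c a b d a′ b′ → monomial c a b ⊠ monomial d a′ b′ ≐ monomial (c * d) (a + a′) (b + b′)
  monomial-⊠-monomial c a b d a′ b′ = coeffwise coeff-≃
    where
    coeff-≃ : ∀ i k → (monomial c a b ⊠ monomial d a′ b′) i k ≃ monomial (c * d) (a + a′) (b + b′) i k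
    coeff-≃ i k with a ≤? i | b ≤? k
    ... | yes a≤i | yes b≤k = ℤₚ.trans (monomial-⊠-coeff c a b (monomial d a′ b′) a≤i b≤k) (≃-reflexive (begin
          c * (d * (δ a′ (i ∸ a) * δ b′ (k ∸ b)))   ≡⟨ cong₂ (λ u v → c * (d * (u * v))) (δ-∸ a a′ a≤i) (δ-∸ b b′ b≤k) ⟩
          c * (d * (δ (a + a′) i * δ (b + b′) k))   ≡⟨ ℕ.*-assoc c d _ ⟨
          c * d * (δ (a + a′) i * δ (b + b′) k)     ∎))
          where open ≡-Reasoning
    ... | no a≰i | _ = ℤₚ.trans (monomial-⊠-coeff-< c a b (monomial d a′ b′) (inj₁ (ℕ.≰⇒> a≰i)))
                         (≃-reflexive (sym (monomial-off (c * d) (a + a′) (b + b′) λ (i≡a+a′ , _) →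
                           a≰i (ℕ.≤-trans (ℕ.m≤m+n a a′) (ℕ.≤-reflexive (sym i≡a+a′))))))
    ... | yes _ | no b≰k = ℤₚ.trans (monomial-⊠-coeff-< c a b (monomial d a′ b′) (inj₂ (ℕ.≰⇒> b≰k)))
                         (≃-reflexive (sym (monomial-off (c * d) (a + a′) (b + b′) λ (_ , k≡b+b′) →
                           b≰k (ℕ.≤-trans (ℕ.m≤m+n b b′) (ℕ.≤-reflexive (sym k≡b+b′))))))

  monomial-cong : ∀ {c c′} a b → c ≃ c′ → monomial c a b ≐ monomial c′ a b
  monomial-cong a b c≃c′ = coeffwise λ i k → ℤₚ.*-congʳ c≃c′

  X≐monomial : X ≐ monomial 1 1 0
  X≐monomial = coeffwise λ
    { zero          k       → ≃-reflexive refl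
    ; (suc zero)    zero    → ≃-reflexive refl
    ; (suc zero)    (suc k) → ≃-reflexive refl
    ; (suc (suc i)) k       → ≃-reflexive refl }

  Y≐monomial : Y ≐ monomial 1 0 1
  Y≐monomial = coeffwise λ
    { zero    zero          → ≃-reflexive refl
    ; zero    (suc zero)    → ≃-reflexive refl
    ; zero    (suc (suc k)) → ≃-reflexive refl
    ; (suc i) k             → ≃-reflexive refl }

  oneP≐monomial : oneP ≐ monomial 1 0 0
  oneP≐monomial = coeffwise λ
    { zero    zero    → ≃-reflexive refl
    ; zero    (suc k) → ≃-reflexive refl
    ; (suc i) k       → ≃-reflexive refl }

  X^≐monomial : ∀ n → X ^ n ≐ monomial 1 n 0
  X^≐monomial zero    = oneP≐monomial
  X^≐monomial (suc n) = 𝔽[x,y].trans (*-cong X≐monomial (X^≐monomial n)) (monomial-⊠-monomial 1 1 0 1 n 0)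

  Y^≐monomial : ∀ n → Y ^ n ≐ monomial 1 0 n
  Y^≐monomial zero    = oneP≐monomial
  Y^≐monomial (suc n) = 𝔽[x,y].trans (*-cong Y≐monomial (Y^≐monomial n)) (monomial-⊠-monomial 1 0 1 1 0 n)

  X⊠-coeff-zero : ∀ s k → (X ⊠ s) 0 k ≃ 0
  X⊠-coeff-zero s k = ℤₚ.trans (coeff (*-congʳ X≐monomial) 0 k) (monomial-⊠-coeff-< 1 1 0 s (inj₁ (s≤s z≤n)))

  X⊠-coeff-suc : ∀ s i k → (X ⊠ s) (suc i) k ≃ s i k
  X⊠-coeff-suc s i k = ℤₚ.trans (coeff (*-congʳ X≐monomial) (suc i) k)
    (ℤₚ.trans (monomial-⊠-coeff 1 1 0 s (s≤s z≤n) z≤n) (ℤₚ.*-identityˡ _))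

  Y⊠-coeff-zero : ∀ s i → (Y ⊠ s) i 0 ≃ 0
  Y⊠-coeff-zero s i = ℤₚ.trans (coeff (*-congʳ Y≐monomial) i 0) (monomial-⊠-coeff-< 1 0 1 s (inj₂ (s≤s z≤n)))

  Y⊠-coeff-suc : ∀ s i k → (Y ⊠ s) i (suc k) ≃ s i k
  Y⊠-coeff-suc s i k = ℤₚ.trans (coeff (*-congʳ Y≐monomial) i (suc k))
    (ℤₚ.trans (monomial-⊠-coeff 1 0 1 s z≤n (s≤s z≤n)) (ℤₚ.*-identityˡ _))

  scalar : ℕ → Coef
  scalar c = monomial c 0 0

  scalar-⊠-coeff : ∀ c s i k → (scalar c ⊠ s) i k ≃ c * s i k
  scalar-⊠-coeff c s i k = monomial-⊠-coeff c 0 0 s z≤n z≤n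

  scalar-≃0 : ∀ {c} → c ≃ 0 → scalar c ≐ zeroP
  scalar-≃0 c≃0 = coeffwise λ i k → *-zeroˡ-≃ _ c≃0

  monomial-⊠-cancel : Prime p → ∀ {c} a b {t} → ¬ p ∣ c → monomial c a b ⊠ t ≐ zeroP → t ≐ zeroP
  monomial-⊠-cancel p-prime {c} a b {t} p∤c ct≐0 = coeffwise λ i k →
    *-cancelˡ-≃0 p-prime p∤c (ℤₚ.trans (ℤₚ.sym (ℤₚ.trans (monomial-⊠-coeff c a b t (ℕ.m≤m+n a i) (ℕ.m≤m+n b k))
      (≃-reflexive (cong₂ (λ u v → c * t u v) (ℕ.m+n∸m≡n a i) (ℕ.m+n∸m≡n b k))))) (coeff ct≐0 (a + i) (b + k)))

  binomial-theorem : ∀ m → (X ⊞ Y) ^ m ≐ binomial m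
  binomial-theorem zero = 𝔽[x,y].trans oneP≐monomial (coeffwise λ
    { zero    zero    → ≃-reflexive refl
    ; zero    (suc k) → ≃-reflexive refl
    ; (suc i) k       → ≃-reflexive refl })
  binomial-theorem (suc m) =
    𝔽[x,y].trans (*-congˡ (binomial-theorem m)) (𝔽[x,y].trans (distribʳ (binomial m) X Y) (coeffwise pascal))
    where
    pascal : ∀ i k → (X ⊠ binomial m ⊞ Y ⊠ binomial m) i k ≃ binomial (suc m) i k
    pascal i k rewrite ⊞-coeff (X ⊠ binomial m) (Y ⊠ binomial m) i k = pascal′ i k
      where
      pascal′ : ∀ i k → (X ⊠ binomial m) i k + (Y ⊠ binomial m) i k ≃ binomial (suc m) i k
      pascal′ zero zero = ℤₚ.trans (ℤₚ.+-cong (X⊠-coeff-zero _ 0) (Y⊠-coeff-zero _ 0)) (≃-reflexive refl)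
      pascal′ zero (suc k) = ℤₚ.trans (ℤₚ.+-cong (X⊠-coeff-zero _ (suc k)) (Y⊠-coeff-suc _ 0 k)) (≃-reflexive refl)
      pascal′ (suc i) zero = ℤₚ.trans (ℤₚ.+-cong (X⊠-coeff-suc _ i 0) (Y⊠-coeff-zero _ (suc i)))
        (≃-reflexive (trans (ℕ.+-identityʳ _) (δ-*-cong (m C i) (suc m C suc i) C≡C)))
        where
        C≡C : m ≡ i + 0 → m C i ≡ suc m C suc i
        C≡C m≡i+0 rewrite ℕ.+-identityʳ i | m≡i+0 = trans (nCn≡1 i) (sym (nCn≡1 (suc i)))
      pascal′ (suc i) (suc k) = ℤₚ.trans (ℤₚ.+-cong (X⊠-coeff-suc _ i (suc k)) (Y⊠-coeff-suc _ (suc i) k))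
        (≃-reflexive (begin
          δ m (i + suc k) * (m C i) + δ m (suc i + k) * (m C suc i)
            ≡⟨ cong (λ n → δ m n * (m C i) + δ m (suc i + k) * (m C suc i)) (ℕ.+-suc i k) ⟩
          δ m (suc i + k) * (m C i) + δ m (suc i + k) * (m C suc i)
            ≡⟨ ℕ.*-distribˡ-+ (δ m (suc i + k)) (m C i) (m C suc i) ⟨
          δ m (suc i + k) * (m C i + m C suc i)
            ≡⟨ cong₂ (λ n c → δ m n * c) (sym (ℕ.+-suc i k)) (nCk+nC[k+1]≡[n+1]C[k+1] m i) ⟩
          δ m (i + suc k) * (suc m C suc i)                         ∎))
        where open ≡-Reasoning

  opaque
    unfolding _⊞_ _⊠_ ⊟_

    IsPoly-⊞ : ∀ {f g} → IsPoly f → IsPoly g → IsPoly (f ⊞ g)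
    IsPoly-⊞ = IsPoly-⊕

    IsPoly-⊠ : ∀ {f g} → IsPoly f → IsPoly g → IsPoly (f ⊠ g)
    IsPoly-⊠ = IsPoly-⊗

    IsPoly-⊟ : ∀ {f} → IsPoly f → IsPoly (⊟ f)
    IsPoly-⊟ = IsPoly-scale (pred p)

  IsPoly-^ : ∀ {f} → IsPoly f → ∀ n → IsPoly (f ^ n)
  IsPoly-^ f-poly zero    = IsPoly-oneP
  IsPoly-^ f-poly (suc n) = IsPoly-⊠ f-poly (IsPoly-^ f-poly n)

  XOrder≥ : ℕ → Coef → Set
  XOrder≥ s f = ∀ i k → i < s → f i k ≃ 0

  YOrder≥ : ℕ → Coef → Set
  YOrder≥ s f = ∀ i k → k < s → f i k ≃ 0

  Homogeneous : ℕ → Coef → Set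
  Homogeneous d f = ∀ i k → i + k ≢ d → f i k ≃ 0

  XOrder≥-⊠ˡ : ∀ h {s F} → XOrder≥ s F → XOrder≥ s (h ⊠ F)
  XOrder≥-⊠ˡ h {F = F} F≃0 i k i<s = ⊠-coeff-zero h F i k λ a b _ _ →
    *-zeroʳ-≃ (h a b) (F≃0 (i ∸ a) (k ∸ b) (ℕ.≤-<-trans (ℕ.m∸n≤m i a) i<s))

  YOrder≥-⊠ˡ : ∀ h {s F} → YOrder≥ s F → YOrder≥ s (h ⊠ F)
  YOrder≥-⊠ˡ h {F = F} F≃0 i k k<s = ⊠-coeff-zero h F i k λ a b _ _ →
    *-zeroʳ-≃ (h a b) (F≃0 (i ∸ a) (k ∸ b) (ℕ.≤-<-trans (ℕ.m∸n≤m k b) k<s))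

  XOrder≥-⊞ : ∀ {s f g} → XOrder≥ s f → XOrder≥ s g → XOrder≥ s (f ⊞ g)
  XOrder≥-⊞ {f = f} {g} f-x g-x i k i<s = ℤₚ.trans (⊞-coeff-≃ f g i k) (ℤₚ.trans (ℤₚ.+-cong (f-x i k i<s) (g-x i k i<s)) (ℤₚ.+-identityˡ 0))

  YOrder≥-⊞ : ∀ {s f g} → YOrder≥ s f → YOrder≥ s g → YOrder≥ s (f ⊞ g)
  YOrder≥-⊞ {f = f} {g} f-y g-y i k k<s = ℤₚ.trans (⊞-coeff-≃ f g i k) (ℤₚ.trans (ℤₚ.+-cong (f-y i k k<s) (g-y i k k<s)) (ℤₚ.+-identityˡ 0))

  XOrder≥-⊟ : ∀ {s f} → XOrder≥ s f → XOrder≥ s (⊟ f)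
  XOrder≥-⊟ {f = f} f-x i k i<s = ℤₚ.trans (≃-reflexive (⊟-coeff f i k)) (*-zeroʳ-≃ (pred p) (f-x i k i<s))

  YOrder≥-⊟ : ∀ {s f} → YOrder≥ s f → YOrder≥ s (⊟ f)
  YOrder≥-⊟ {f = f} f-y i k k<s = ℤₚ.trans (≃-reflexive (⊟-coeff f i k)) (*-zeroʳ-≃ (pred p) (f-y i k k<s))

  YOrder≥-resp-≐ : ∀ {s f g} → f ≐ g → YOrder≥ s g → YOrder≥ s f
  YOrder≥-resp-≐ f≐g g-y i k k<s = ℤₚ.trans (coeff f≐g i k) (g-y i k k<s)

  XOrder≥-monomial-⊠ : ∀ c a b s → XOrder≥ a (monomial c a b ⊠ s)
  XOrder≥-monomial-⊠ c a b s i k i<a = monomial-⊠-coeff-< c a b s (inj₁ i<a)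

  YOrder≥-monomial-⊠ : ∀ c a b s → YOrder≥ b (monomial c a b ⊠ s)
  YOrder≥-monomial-⊠ c a b s i k k<b = monomial-⊠-coeff-< c a b s (inj₂ k<b)

  monomial-factor : ∀ a b {f} → XOrder≥ a f → YOrder≥ b f → f ≐ monomial 1 a b ⊠ shift a b f
  monomial-factor a b {f} f-x f-y = coeffwise coeff-≃
    where
    coeff-≃ : ∀ i k → f i k ≃ (monomial 1 a b ⊠ shift a b f) i k
    coeff-≃ i k with a ≤? i | b ≤? k
    ... | yes a≤i | yes b≤k = ℤₚ.sym (ℤₚ.trans (monomial-⊠-coeff 1 a b (shift a b f) a≤i b≤k)
            (≃-reflexive (trans (ℕ.*-identityˡ _) (cong₂ f (ℕ.m+[n∸m]≡n a≤i) (ℕ.m+[n∸m]≡n b≤k)))))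
    ... | no a≰i | _ = ℤₚ.trans (f-x i k (ℕ.≰⇒> a≰i)) (ℤₚ.sym (monomial-⊠-coeff-< 1 a b (shift a b f) (inj₁ (ℕ.≰⇒> a≰i))))
    ... | yes _ | no b≰k = ℤₚ.trans (f-y i k (ℕ.≰⇒> b≰k)) (ℤₚ.sym (monomial-⊠-coeff-< 1 a b (shift a b f) (inj₂ (ℕ.≰⇒> b≰k))))

  X-homogeneous : Homogeneous 1 X
  X-homogeneous i k i+k≢1 = ≃-reflexive (X-off i k i+k≢1)

  Y-homogeneous : Homogeneous 1 Y
  Y-homogeneous i k i+k≢1 = ≃-reflexive (Y-off i k i+k≢1)

  Homogeneous-⊠ : ∀ {d e F G} → Homogeneous d F → Homogeneous e G → Homogeneous (d + e) (F ⊠ G)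
  Homogeneous-⊠ {d} {e} {F} {G} F≃0 G≃0 i k i+k≢d+e = ⊠-coeff-zero F G i k term≃0
    where
    term≃0 : ∀ a b → a ≤ i → b ≤ k → F a b * G (i ∸ a) (k ∸ b) ≃ 0
    term≃0 a b a≤i b≤k with a + b ≟ d
    ... | no a+b≢d = *-zeroˡ-≃ (G (i ∸ a) (k ∸ b)) (F≃0 a b a+b≢d)
    ... | yes a+b≡d = *-zeroʳ-≃ (F a b) (G≃0 (i ∸ a) (k ∸ b) λ rest≡e →
            i+k≢d+e (trans (sym (∸+∸+[+]≡+ a≤i b≤k)) (trans (cong₂ _+_ rest≡e a+b≡d) (ℕ.+-comm e d))))

  Homogeneous-⊠-below : ∀ {d F} → Homogeneous d F → ∀ h i k → i + k < d → (h ⊠ F) i k ≃ 0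
  Homogeneous-⊠-below {F = F} F≃0 h i k i+k<d = ⊠-coeff-zero h F i k λ a b _ _ →
    *-zeroʳ-≃ (h a b) (F≃0 (i ∸ a) (k ∸ b) λ e →
      ℕ.<⇒≱ i+k<d (ℕ.≤-trans (ℕ.≤-reflexive (sym e)) (ℕ.+-mono-≤ (ℕ.m∸n≤m i a) (ℕ.m∸n≤m k b))))

  Homogeneous-⊠-coeff : ∀ {d F} → Homogeneous d F → ∀ c i k → i + k ≤ d → (F ⊠ c) i k ≃ F i k * c 0 0
  Homogeneous-⊠-coeff {F = F} F≃0 c i k i+k≤d =
    ℤₚ.trans (⊠-coeff-single F c i k i k ℕ.≤-refl ℕ.≤-refl λ a b a≤i b≤k ¬on →
               *-zeroˡ-≃ (c (i ∸ a) (k ∸ b)) (F≃0 a b (ℕ.<⇒≢ (ℕ.<-≤-trans (+-mono-≤-≢-< a≤i b≤k ¬on) i+k≤d))))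
             (≃-reflexive (cong₂ (λ u v → F i k * c u v) (ℕ.n∸n≡0 i) (ℕ.n∸n≡0 k)))

  InIdeal⇔ : ∀ a t → InIdeal p a t ⇔ (∃[ h ] IsPoly h × t ≐ a ⊠ h)
  InIdeal⇔ a t = mk⇔
    (λ (h , h-poly , t≈ah) → h , h-poly , ≈ₚ⇒≐ (subst (_≈ₚ_ p t) (sym (⊠≡⊗ a h)) t≈ah))
    (λ (h , h-poly , t≐ah) → h , h-poly , subst (_≈ₚ_ p t) (⊠≡⊗ a h) (≐⇒≈ₚ t≐ah))

  XOrder≥⇔InIdeal : ∀ s {f} → IsPoly f → XOrder≥ s f ⇔ InIdeal p (X ^P s) f
  XOrder≥⇔InIdeal s {f} f-poly = mk⇔
    (λ f-x → Equivalence.from (InIdeal⇔ _ f) (shift s 0 f , IsPoly-shift s 0 f-poly ,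
       𝔽[x,y].trans (monomial-factor s 0 f-x (λ _ _ ())) (*-congʳ X^P≐monomial)))
    (λ f∈ → let (h , _ , f≐X^h) = Equivalence.to (InIdeal⇔ _ f) f∈ in
       λ i k i<s → ℤₚ.trans (coeff f≐X^h i k)
         (ℤₚ.trans (coeff (*-congʳ (𝔽[x,y].sym X^P≐monomial)) i k) (XOrder≥-monomial-⊠ 1 s 0 h i k i<s)))
    where
    X^P≐monomial : monomial 1 s 0 ≐ X ^P s
    X^P≐monomial = 𝔽[x,y].sym (subst (_≐ monomial 1 s 0) (sym (^P≡^ X s)) (X^≐monomial s))

  YOrder≥⇔InIdeal : ∀ s {f} → IsPoly f → YOrder≥ s f ⇔ InIdeal p (Y ^P s) f
  YOrder≥⇔InIdeal s {f} f-poly = mk⇔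
    (λ f-y → Equivalence.from (InIdeal⇔ _ f) (shift 0 s f , IsPoly-shift 0 s f-poly ,
       𝔽[x,y].trans (monomial-factor 0 s (λ _ _ ()) f-y) (*-congʳ Y^P≐monomial)))
    (λ f∈ → let (h , _ , f≐Y^h) = Equivalence.to (InIdeal⇔ _ f) f∈ in
       λ i k k<s → ℤₚ.trans (coeff f≐Y^h i k)
         (ℤₚ.trans (coeff (*-congʳ (𝔽[x,y].sym Y^P≐monomial)) i k) (YOrder≥-monomial-⊠ 1 0 s h i k k<s)))
    where
    Y^P≐monomial : monomial 1 0 s ≐ Y ^P s
    Y^P≐monomial = 𝔽[x,y].sym (subst (_≐ monomial 1 0 s) (sym (^P≡^ Y s)) (Y^≐monomial s))

  InDCoeff : ℕ → ℕ → ℕ → Coef → Coef → Set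
  InDCoeff a b n f g = IsPoly f × IsPoly g × XOrder≥ a f × YOrder≥ b g × (∃[ c ] IsPoly c × f ⊞ g ≐ (X ⊞ Y) ^ n ⊠ c)

  InD⇔ : ∀ a b n f g → InD p (a , b , n) (f , g) ⇔ InDCoeff a b n f g
  InD⇔ a b n f g = mk⇔
    (λ ((f-poly , g-poly) , f∈ , g∈ , (c , c-poly , f+g≈Ec)) →
       f-poly , g-poly , Equivalence.from (XOrder≥⇔InIdeal a f-poly) f∈ , Equivalence.from (YOrder≥⇔InIdeal b g-poly) g∈ ,
       c , c-poly , subst₂ (λ u v → u ≐ v ⊠ c) (sym (⊞≡⊕ f g)) E≡ (≈ₚ⇒≐ (subst (_≈ₚ_ p (f ⊕ g)) (sym (⊠≡⊗ _ c)) f+g≈Ec)))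
    (λ (f-poly , g-poly , f-x , g-y , c , c-poly , f+g≐Ec) →
       (f-poly , g-poly) , Equivalence.to (XOrder≥⇔InIdeal a f-poly) f-x , Equivalence.to (YOrder≥⇔InIdeal b g-poly) g-y ,
       c , c-poly , subst (_≈ₚ_ p (f ⊕ g)) (⊠≡⊗ _ c) (≐⇒≈ₚ (subst₂ (λ u v → u ≐ v ⊠ c) (⊞≡⊕ f g) (sym E≡) f+g≐Ec)))
    where
    E≡ : (X ⊕ Y) ^P n ≡ (X ⊞ Y) ^ n
    E≡ = trans (^P≡^ (X ⊕ Y) n) (cong (_^ n) (sym (⊞≡⊕ X Y)))

  xAbove-⊞-xUpTo : ∀ t P → xAbove t P ⊞ xUpTo t P ≐ P
  xAbove-⊞-xUpTo t P = coeffwise λ i k → ℤₚ.trans (⊞-coeff-≃ _ _ i k) (split i k)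
    where
    split : ∀ i k → xAbove t P i k + xUpTo t P i k ≃ P i k
    split i k with t <? i
    ... | yes _ = ≃-reflexive (ℕ.+-identityʳ _)
    ... | no  _ = ℤₚ.refl

  xAbove-cong : ∀ t {P Q} → P ≐ Q → xAbove t P ≐ xAbove t Q
  xAbove-cong t {P} {Q} P≐Q = coeffwise pointwise
    where
    pointwise : ∀ i k → xAbove t P i k ≃ xAbove t Q i k
    pointwise i k with t <? i
    ... | yes _ = coeff P≐Q i k
    ... | no  _ = ℤₚ.refl

  Y-⊠-xAbove : ∀ t P → Y ⊠ xAbove t P ≐ xAbove t (Y ⊠ P)
  Y-⊠-xAbove t P = coeffwise pointwise
    where
    pointwise : ∀ i k → (Y ⊠ xAbove t P) i k ≃ xAbove t (Y ⊠ P) i k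
    pointwise i k with t <? i | k
    ... | yes t<i | zero  = ℤₚ.trans (Y⊠-coeff-zero _ i) (ℤₚ.sym (Y⊠-coeff-zero P i))
    ... | yes t<i | suc k = ℤₚ.trans (Y⊠-coeff-suc _ i k) (ℤₚ.trans (≃-reflexive (xAbove-yes t<i P k)) (ℤₚ.sym (Y⊠-coeff-suc P i k)))
    ... | no  _   | zero  = Y⊠-coeff-zero _ i
    ... | no  t≮i | suc k = ℤₚ.trans (Y⊠-coeff-suc _ i k) (≃-reflexive (xAbove-no t≮i P k))

  X-⊠-xAbove : ∀ t P → X ⊠ xAbove t P ≐ xAbove (suc t) (X ⊠ P)
  X-⊠-xAbove t P = coeffwise pointwise
    where
    pointwise : ∀ i k → (X ⊠ xAbove t P) i k ≃ xAbove (suc t) (X ⊠ P) i k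
    pointwise zero    k = X⊠-coeff-zero _ k
    pointwise (suc i) k with t <? i
    ... | yes t<i = ℤₚ.trans (X⊠-coeff-suc _ i k) (ℤₚ.trans (≃-reflexive (xAbove-yes t<i P k))
                      (ℤₚ.sym (ℤₚ.trans (≃-reflexive (xAbove-yes (s≤s t<i) (X ⊠ P) k)) (X⊠-coeff-suc P i k))))
    ... | no  t≮i = ℤₚ.trans (X⊠-coeff-suc _ i k) (ℤₚ.trans (≃-reflexive (xAbove-no t≮i P k))
                      (≃-reflexive (sym (xAbove-no (λ 1+t<1+i → t≮i (ℕ.≤-pred 1+t<1+i)) (X ⊠ P) k))))

  XOrder≥-xAbove : ∀ t P → XOrder≥ (suc t) (xAbove t P)
  XOrder≥-xAbove t P i k i<1+t = ≃-reflexive (xAbove-no (ℕ.≤⇒≯ (ℕ.≤-pred i<1+t)) P k)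

  YOrder≥-xUpTo : ∀ t s P → (∀ i k → i ≤ t → k < s → P i k ≃ 0) → YOrder≥ s (xUpTo t P)
  YOrder≥-xUpTo t s P P≃0 i k k<s with t <? i
  ... | yes _   = ℤₚ.refl
  ... | no  t≮i = P≃0 i k (ℕ.≮⇒≥ t≮i) k<s

  Homogeneous-xAbove : ∀ t {d P} → Homogeneous d P → Homogeneous d (xAbove t P)
  Homogeneous-xAbove t {P = P} P≃0 i k i+k≢d with t <? i
  ... | yes _ = P≃0 i k i+k≢d
  ... | no  _ = ℤₚ.refl

  Homogeneous-xUpTo : ∀ t {d P} → Homogeneous d P → Homogeneous d (xUpTo t P)
  Homogeneous-xUpTo t {P = P} P≃0 i k i+k≢d with t <? i
  ... | yes _ = ℤₚ.refl
  ... | no  _ = P≃0 i k i+k≢d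

  X⊞Y-⊠-cancel : ∀ {w} → (X ⊞ Y) ⊠ w ≐ zeroP → w ≐ zeroP
  X⊞Y-⊠-cancel {w} [X+Y]w≐0 = coeffwise w≃0
    where
    Xw+Yw≃0 : ∀ i k → (X ⊠ w) i k + (Y ⊠ w) i k ≃ 0
    Xw+Yw≃0 i k = ℤₚ.trans (ℤₚ.sym (⊞-coeff-≃ (X ⊠ w) (Y ⊠ w) i k))
                    (coeff (𝔽[x,y].trans (𝔽[x,y].sym (distribʳ w X Y)) [X+Y]w≐0) i k)
    w≃0 : ∀ i k → w i k ≃ 0
    w≃0 zero    k = ℤₚ.trans (ℤₚ.sym (ℤₚ.trans (ℤₚ.+-cong (X⊠-coeff-zero w (suc k)) (Y⊠-coeff-suc w 0 k)) (ℤₚ.+-identityˡ _)))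
                             (Xw+Yw≃0 0 (suc k))
    w≃0 (suc i) k = ℤₚ.trans (ℤₚ.sym (ℤₚ.trans (ℤₚ.+-cong (ℤₚ.trans (X⊠-coeff-suc w i (suc k)) (w≃0 i (suc k))) (Y⊠-coeff-suc w (suc i) k))
                                               (ℤₚ.+-identityˡ _)))
                             (Xw+Yw≃0 (suc i) (suc k))

  ^-⊠-cancel : ∀ {a} → (∀ {w} → a ⊠ w ≐ zeroP → w ≐ zeroP) → ∀ n {w} → a ^ n ⊠ w ≐ zeroP → w ≐ zeroP
  ^-⊠-cancel a-cancel zero    {w} 1w≐0 = 𝔽[x,y].trans (𝔽[x,y].sym (*-identityˡ w)) 1w≐0
  ^-⊠-cancel a-cancel (suc n) {w} aⁿ⁺¹w≐0 = ^-⊠-cancel a-cancel n (a-cancel (𝔽[x,y].trans (𝔽[x,y].sym (*-assoc _ _ w)) aⁿ⁺¹w≐0))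

  X-Y-syzygy : ∀ {a b} → X ⊠ a ⊞ Y ⊠ b ≐ zeroP → a ≐ Y ⊠ shift 0 1 a × b ⊞ X ⊠ shift 0 1 a ≐ zeroP
  X-Y-syzygy {a} {b} Xa+Yb≐0 = coeffwise a≃Yt , coeffwise b+Xt≃0
    where
    t : Coef
    t = shift 0 1 a
    Xa+Yb≃0 : ∀ i k → (X ⊠ a) i k + (Y ⊠ b) i k ≃ 0
    Xa+Yb≃0 i k = ℤₚ.trans (ℤₚ.sym (⊞-coeff-≃ (X ⊠ a) (Y ⊠ b) i k)) (coeff Xa+Yb≐0 i k)
    a≃Yt : ∀ i k → a i k ≃ (Y ⊠ t) i k
    a≃Yt i zero = ℤₚ.trans (ℤₚ.trans (ℤₚ.sym (ℤₚ.trans (ℤₚ.+-cong (X⊠-coeff-suc a i 0) (Y⊠-coeff-zero b (suc i))) (ℤₚ.+-identityʳ _)))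
                                      (Xa+Yb≃0 (suc i) 0))
                           (ℤₚ.sym (Y⊠-coeff-zero t i))
    a≃Yt i (suc k) = ℤₚ.sym (Y⊠-coeff-suc t i k)
    b+Xt≃0 : ∀ i k → (b ⊞ X ⊠ t) i k ≃ 0
    b+Xt≃0 zero k = ℤₚ.trans (⊞-coeff-≃ b (X ⊠ t) 0 k) (ℤₚ.trans (ℤₚ.+-cong
      (ℤₚ.trans (ℤₚ.sym (ℤₚ.trans (ℤₚ.+-cong (X⊠-coeff-zero a (suc k)) (Y⊠-coeff-suc b 0 k)) (ℤₚ.+-identityˡ _))) (Xa+Yb≃0 0 (suc k)))
      (X⊠-coeff-zero t k)) (ℤₚ.+-identityˡ 0))
    b+Xt≃0 (suc i) k = ℤₚ.trans (⊞-coeff-≃ b (X ⊠ t) (suc i) k) (ℤₚ.trans (ℤₚ.+-comm (b (suc i) k) ((X ⊠ t) (suc i) k))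
      (ℤₚ.trans (ℤₚ.sym (ℤₚ.+-cong (ℤₚ.trans (X⊠-coeff-suc a i (suc k)) (ℤₚ.sym (X⊠-coeff-suc t i k))) (Y⊠-coeff-suc b (suc i) k)))
                (Xa+Yb≃0 (suc i) (suc k))))

  constant-term-split : ∀ c → c ≐ X ⊠ shift 1 0 c ⊞ Y ⊠ xUpTo 0 (shift 0 1 c) ⊞ scalar (c 0 0)
  constant-term-split c = coeffwise λ i k → ℤₚ.sym (ℤₚ.trans (rhs-coeff i k) (split i k))
    where
    h₁ h₂ : Coef
    h₁ = shift 1 0 c
    h₂ = xUpTo 0 (shift 0 1 c)
    rhs-coeff : ∀ i k → (X ⊠ h₁ ⊞ Y ⊠ h₂ ⊞ scalar (c 0 0)) i k ≃ (X ⊠ h₁) i k + (Y ⊠ h₂) i k + scalar (c 0 0) i k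
    rhs-coeff i k = ℤₚ.trans (⊞-coeff-≃ _ _ i k) (ℤₚ.+-congʳ (⊞-coeff-≃ _ _ i k))
    split : ∀ i k → (X ⊠ h₁) i k + (Y ⊠ h₂) i k + scalar (c 0 0) i k ≃ c i k
    split zero zero = ℤₚ.trans (ℤₚ.+-congʳ (ℤₚ.+-cong (X⊠-coeff-zero h₁ 0) (Y⊠-coeff-zero h₂ 0)))
                               (≃-reflexive (ℕ.*-identityʳ (c 0 0)))
    split zero (suc k) = ℤₚ.trans (ℤₚ.+-congʳ (ℤₚ.+-cong (X⊠-coeff-zero h₁ (suc k)) (Y⊠-coeff-suc h₂ 0 k)))
                                  (≃-reflexive (trans (cong (c 0 (suc k) +_) (ℕ.*-zeroʳ (c 0 0))) (ℕ.+-identityʳ _)))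
    split (suc i) zero = ℤₚ.trans (ℤₚ.+-congʳ (ℤₚ.+-cong (X⊠-coeff-suc h₁ i 0) (Y⊠-coeff-zero h₂ (suc i))))
                                  (≃-reflexive (trans (cong (c (suc i) 0 + 0 +_) (ℕ.*-zeroʳ (c 0 0))) (trans (ℕ.+-identityʳ _) (ℕ.+-identityʳ _))))
    split (suc i) (suc k) = ℤₚ.trans (ℤₚ.+-congʳ (ℤₚ.+-cong (X⊠-coeff-suc h₁ i (suc k)) (Y⊠-coeff-suc h₂ (suc i) k)))
                                     (≃-reflexive (trans (cong (c (suc i) (suc k) + 0 +_) (ℕ.*-zeroʳ (c 0 0))) (trans (ℕ.+-identityʳ _) (ℕ.+-identityʳ _))))

  infix 4 _≐D_
  _≐D_ : Der → Der → Set
  (f , g) ≐D (f′ , g′) = f ≐ f′ × g ≐ g′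

  infixr 7 _·D_
  _·D_ : Coef → Der → Der
  h ·D (f , g) = h ⊠ f , h ⊠ g

  combine : Coef → Der → Coef → Der → Der
  combine h₁ (f₁ , g₁) h₂ (f₂ , g₂) = h₁ ⊠ f₁ ⊞ h₂ ⊠ f₂ , h₁ ⊠ g₁ ⊞ h₂ ⊠ g₂

  Spans : Mult → Der → Der → Set
  Spans μ θ₁ θ₂ = ∀ θ → InD p μ θ → ∃[ h₁ ] ∃[ h₂ ] IsPoly h₁ × IsPoly h₂ × θ ≐D combine h₁ θ₁ h₂ θ₂

  Independent : Der → Der → Set
  Independent θ₁ θ₂ = ∀ h₁ h₂ → IsPoly h₁ → IsPoly h₂ → combine h₁ θ₁ h₂ θ₂ ≐D (zeroP , zeroP) → h₁ ≐ zeroP × h₂ ≐ zeroP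

  opaque
    unfolding _⊞_ _⊠_

    lin≡combine : ∀ h₁ θ₁ h₂ θ₂ → lin p h₁ θ₁ h₂ θ₂ ≡ combine h₁ θ₁ h₂ θ₂
    lin≡combine h₁ θ₁ h₂ θ₂ = refl

  ≈D⇔≐D : ∀ θ θ′ → _≈D_ p θ θ′ ⇔ θ ≐D θ′
  ≈D⇔≐D θ θ′ = mk⇔ (λ (f≈ , g≈) → ≈ₚ⇒≐ f≈ , ≈ₚ⇒≐ g≈) (λ (f≐ , g≐) → ≐⇒≈ₚ f≐ , ≐⇒≈ₚ g≐)

  IsBasis⇔ : ∀ μ θ₁ θ₂ → IsBasis p μ θ₁ θ₂ ⇔ (InD p μ θ₁ × InD p μ θ₂ × Spans μ θ₁ θ₂ × Independent θ₁ θ₂)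
  IsBasis⇔ μ θ₁ θ₂ = mk⇔
    (λ (θ₁∈ , θ₂∈ , spans , independent) → θ₁∈ , θ₂∈ , spans⇒ spans , independent⇒ independent)
    (λ (θ₁∈ , θ₂∈ , spans , independent) → θ₁∈ , θ₂∈ , ⇒spans spans , ⇒independent independent)
    where
    LinSpans LinIndependent : Set
    LinSpans = ∀ θ → InD p μ θ → ∃[ h₁ ] ∃[ h₂ ] IsPoly h₁ × IsPoly h₂ × _≈D_ p θ (lin p h₁ θ₁ h₂ θ₂)
    LinIndependent = ∀ h₁ h₂ → IsPoly h₁ → IsPoly h₂ → _≈D_ p (lin p h₁ θ₁ h₂ θ₂) (zeroP , zeroP) → _≈ₚ_ p h₁ zeroP × _≈ₚ_ p h₂ zeroP
    lin≈D⇔combine≐D : ∀ h₁ h₂ θ → _≈D_ p θ (lin p h₁ θ₁ h₂ θ₂) ⇔ θ ≐D combine h₁ θ₁ h₂ θ₂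
    lin≈D⇔combine≐D h₁ h₂ θ =
      subst (λ θ′ → _≈D_ p θ θ′ ⇔ θ ≐D combine h₁ θ₁ h₂ θ₂) (sym (lin≡combine h₁ θ₁ h₂ θ₂)) (≈D⇔≐D θ _)
    lin≈D0⇔combine≐D0 : ∀ h₁ h₂ → _≈D_ p (lin p h₁ θ₁ h₂ θ₂) (zeroP , zeroP) ⇔ combine h₁ θ₁ h₂ θ₂ ≐D (zeroP , zeroP)
    lin≈D0⇔combine≐D0 h₁ h₂ =
      subst (λ θ′ → _≈D_ p θ′ (zeroP , zeroP) ⇔ combine h₁ θ₁ h₂ θ₂ ≐D (zeroP , zeroP)) (sym (lin≡combine h₁ θ₁ h₂ θ₂)) (≈D⇔≐D _ _)
    spans⇒ : LinSpans → Spans μ θ₁ θ₂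
    spans⇒ spans θ θ∈ with spans θ θ∈
    ... | h₁ , h₂ , h₁-poly , h₂-poly , θ≈ = h₁ , h₂ , h₁-poly , h₂-poly , Equivalence.to (lin≈D⇔combine≐D h₁ h₂ θ) θ≈
    ⇒spans : Spans μ θ₁ θ₂ → LinSpans
    ⇒spans spans θ θ∈ with spans θ θ∈
    ... | h₁ , h₂ , h₁-poly , h₂-poly , θ≐ = h₁ , h₂ , h₁-poly , h₂-poly , Equivalence.from (lin≈D⇔combine≐D h₁ h₂ θ) θ≐
    independent⇒ : LinIndependent → Independent θ₁ θ₂
    independent⇒ independent h₁ h₂ h₁-poly h₂-poly comb≐0
      with independent h₁ h₂ h₁-poly h₂-poly (Equivalence.from (lin≈D0⇔combine≐D0 h₁ h₂) comb≐0)
    ... | h₁≈0 , h₂≈0 = ≈ₚ⇒≐ h₁≈0 , ≈ₚ⇒≐ h₂≈0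
    ⇒independent : Independent θ₁ θ₂ → LinIndependent
    ⇒independent independent h₁ h₂ h₁-poly h₂-poly lin≈0
      with independent h₁ h₂ h₁-poly h₂-poly (Equivalence.to (lin≈D0⇔combine≐D0 h₁ h₂) lin≈0)
    ... | h₁≐0 , h₂≐0 = ≐⇒≈ₚ h₁≐0 , ≐⇒≈ₚ h₂≐0

  Homogeneous⇔HomP : ∀ d f → Homogeneous d f ⇔ HomP p d f
  Homogeneous⇔HomP d f = mk⇔ (λ f≃0 i k i+k≢d → ≃⇒≡ₚ (f≃0 i k i+k≢d)) (λ f≡ₚ0 i k i+k≢d → ≡ₚ⇒≃ (f≡ₚ0 i k i+k≢d))

  proportional⇒¬independent : Prime p → ∀ {θ₁ θ₂} ψ c₁ c₂ → θ₁ ≐D scalar c₁ ·D ψ → θ₂ ≐D scalar c₂ ·D ψ → ¬ Independent θ₁ θ₂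
  proportional⇒¬independent p-prime {θ₁} {θ₂} (ψf , ψg) c₁ c₂ (f₁≐ , g₁≐) (f₂≐ , g₂≐) independent =
    1≄0 p-prime (coeff (proj₁ (independent oneP zeroP IsPoly-oneP IsPoly-zeroP (θ₁-only f₁≐ , θ₁-only g₁≐))) 0 0)
    where
    open import Relation.Binary.Reasoning.Setoid 𝔽[x,y].setoid
    open RingProperties 𝔽[x,y].ring using (-‿distribˡ-*)
    open AbelianGroupProperties 𝔽[x,y].+-abelianGroup using (⁻¹-injective; ε⁻¹≈ε)
    a b : Coef
    a = scalar c₁
    b = scalar c₂
    cross-cancel : ∀ {u v w} → u ≐ a ⊠ w → v ≐ b ⊠ w → b ⊠ u ⊞ ⊟ a ⊠ v ≐ zeroP
    cross-cancel {u} {v} {w} u≐ v≐ = begin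
      b ⊠ u ⊞ ⊟ a ⊠ v               ≈⟨ +-cong (*-congˡ u≐) (*-congˡ v≐) ⟩
      b ⊠ (a ⊠ w) ⊞ ⊟ a ⊠ (b ⊠ w)   ≈⟨ +-cong bac≐abc (𝔽[x,y].sym (-‿distribˡ-* a (b ⊠ w))) ⟩
      a ⊠ (b ⊠ w) ⊞ ⊟ (a ⊠ (b ⊠ w)) ≈⟨ -‿inverseʳ _ ⟩
      zeroP                         ∎
      where
      bac≐abc : b ⊠ (a ⊠ w) ≐ a ⊠ (b ⊠ w)
      bac≐abc = 𝔽[x,y].trans (𝔽[x,y].sym (*-assoc b a w)) (𝔽[x,y].trans (*-congʳ (*-comm b a)) (*-assoc a b w))
    a≐0 : a ≐ zeroP
    a≐0 = ⁻¹-injective (𝔽[x,y].trans (proj₂ (independent b (⊟ a) (IsPoly-monomial c₂ 0 0) (IsPoly-⊟ (IsPoly-monomial c₁ 0 0))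
            (cross-cancel f₁≐ f₂≐ , cross-cancel g₁≐ g₂≐))) (𝔽[x,y].sym ε⁻¹≈ε))
    vanishes : ∀ {u w} → u ≐ a ⊠ w → u ≐ zeroP
    vanishes u≐ = 𝔽[x,y].trans u≐ (𝔽[x,y].trans (*-congʳ a≐0) (zeroˡ _))
    θ₁-only : ∀ {u v w} → u ≐ a ⊠ w → oneP ⊠ u ⊞ zeroP ⊠ v ≐ zeroP
    θ₁-only {u} {v} u≐ = 𝔽[x,y].trans (+-cong (𝔽[x,y].trans (*-identityˡ u) (vanishes u≐)) (zeroˡ v))
                                      (+-identityˡ zeroP)

module Multiplicity (p : ℕ) .{{_ : NonZero p}} (m j : ℕ) (j≤m : j ≤ m) where

  open PolynomialRing p public

  r : ℕ
  r = m ∸ j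

  j+r≡m : j + r ≡ m
  j+r≡m = ℕ.m+[n∸m]≡n j≤m

  μ : Mult
  μ = (j + 1 , (m + 1) ∸ j , m)

  E : Coef
  E = (X ⊞ Y) ^ m

  InD-μ⇔ : ∀ f g → InD p μ (f , g) ⇔ InDCoeff (suc j) (suc r) m f g
  InD-μ⇔ f g = subst (λ μ′ → InD p μ′ (f , g) ⇔ InDCoeff (suc j) (suc r) m f g) (sym μ≡) (InD⇔ (suc j) (suc r) m f g)
    where
    μ≡ : μ ≡ (suc j , suc r , m)
    μ≡ = cong₂ _,_ (ℕ.+-comm j 1) (cong (_, m) (trans (cong (_∸ j) (ℕ.+-comm m 1)) (ℕ.+-∸-assoc 1 j≤m)))

  E-poly : IsPoly E
  E-poly = IsPoly-^ (IsPoly-⊞ IsPoly-X IsPoly-Y) m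

  E-coeff : ∀ i k → E i k ≃ binomial m i k
  E-coeff = coeff (binomial-theorem m)

  E-homogeneous : Homogeneous m E
  E-homogeneous i k i+k≢m = ℤₚ.trans (E-coeff i k) (≃-reflexive (cong (_* (m C i)) (δ-≢ (λ m≡i+k → i+k≢m (sym m≡i+k)))))

  E-coeff-row : ∀ k → E j k ≃ δ r k * (m C j)
  E-coeff-row k = ℤₚ.trans (E-coeff j k) (≃-reflexive (cong (_* (m C j)) (trans (cong (λ n → δ n (j + k)) (sym j+r≡m)) (δ-+ j))))

  E-coeff-m0 : E m 0 ≃ 1
  E-coeff-m0 = ℤₚ.trans (E-coeff m 0) (≃-reflexive (begin
    δ m (m + 0) * (m C m) ≡⟨ cong₂ (λ u v → δ m u * v) (ℕ.+-identityʳ m) (nCn≡1 m) ⟩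
    δ m m * 1             ≡⟨ cong (_* 1) (δ-refl m) ⟩
    1                     ∎))
    where open ≡-Reasoning

module EqualExponents (p : ℕ) .{{_ : NonZero p}} (p-prime : Prime p) (m j : ℕ) (j≤m : j ≤ m) (p∤C : ¬ p ∣ m C j) where

  open Multiplicity p m j j≤m
  open import Algebra.Solver.Ring.NaturalCoefficients.Default 𝔽[x,y].commutativeSemiring
  open import Relation.Binary.Reasoning.Setoid 𝔽[x,y].setoid
  open AbelianGroupProperties 𝔽[x,y].+-abelianGroup using (∙-cancelˡ)

  P₁ P₂ Q M : Coef
  P₁ = E ⊠ X
  P₂ = E ⊠ Y
  Q  = X ⊠ (Y ⊠ E)
  M  = monomial (m C j) (suc j) (suc r)

  F₁ G₁ F₂ G₂ : Coef
  F₁ = xAbove j P₁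
  G₁ = xUpTo j P₁
  F₂ = xAbove j P₂
  G₂ = xUpTo j P₂

  φ₁ φ₂ : Der
  φ₁ = F₁ , G₁
  φ₂ = F₂ , G₂

  xAbove-slice : xAbove j Q ≐ xAbove (suc j) Q ⊞ M
  xAbove-slice = coeffwise λ i k → ℤₚ.trans (slice i k) (ℤₚ.sym (⊞-coeff-≃ _ _ i k))
    where
    M-off : ∀ {i} k → i ≢ suc j → M i k ≡ 0
    M-off {i} k i≢1+j = monomial-off (m C j) (suc j) (suc r) {i} {k} (λ (i≡1+j , _) → i≢1+j i≡1+j)
    corner : ∀ k → Q (suc j) k ≃ M (suc j) k
    corner zero    = ℤₚ.trans (X⊠-coeff-suc _ j 0)
                       (ℤₚ.trans (Y⊠-coeff-zero E j) (≃-reflexive (sym (monomial-off (m C j) (suc j) (suc r) {suc j} {0} λ ()))))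
    corner (suc k) = ℤₚ.trans (X⊠-coeff-suc _ j (suc k)) (ℤₚ.trans (Y⊠-coeff-suc E j k) (ℤₚ.trans (E-coeff-row k)
                       (≃-reflexive (sym M-corner))))
      where
      M-corner : M (suc j) (suc k) ≡ δ r k * (m C j)
      M-corner = trans (cong (λ d → (m C j) * (d * δ r k)) (δ-refl j))
                       (trans (cong ((m C j) *_) (ℕ.*-identityˡ (δ r k))) (ℕ.*-comm (m C j) (δ r k)))
    slice : ∀ i k → xAbove j Q i k ≃ xAbove (suc j) Q i k + M i k
    slice i k with j <? i | suc j <? i
    ... | no j≮i   | yes 1+j<i = ⊥-elim (j≮i (ℕ.<-trans (ℕ.n<1+n j) 1+j<i))
    ... | no j≮i   | no _      = ≃-reflexive (sym (M-off {i} k λ { refl → j≮i (ℕ.n<1+n j) }))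
    ... | yes _    | yes 1+j<i = ≃-reflexive (sym (trans (cong (Q i k +_) (M-off {i} k λ { refl → ℕ.<-irrefl refl 1+j<i })) (ℕ.+-identityʳ _)))
    ... | yes j<i  | no 1+j≮i  = subst (λ i → Q i k ≃ M i k) (sym (ℕ.≤-antisym (ℕ.≮⇒≥ 1+j≮i) j<i)) (corner k)

  Y⊠P₁≐Q : Y ⊠ P₁ ≐ Q
  Y⊠P₁≐Q = solve 3 (λ x y e → y :* (e :* x) := x :* (y :* e)) 𝔽[x,y].refl X Y E

  X⊠P₂≐Q : X ⊠ P₂ ≐ Q
  X⊠P₂≐Q = *-congˡ (*-comm E Y)

  Y⊠F₁≐X⊠F₂⊞M : Y ⊠ F₁ ≐ X ⊠ F₂ ⊞ M
  Y⊠F₁≐X⊠F₂⊞M = begin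
    Y ⊠ xAbove j P₁               ≈⟨ Y-⊠-xAbove j P₁ ⟩
    xAbove j (Y ⊠ P₁)             ≈⟨ xAbove-cong j Y⊠P₁≐Q ⟩
    xAbove j Q                    ≈⟨ xAbove-slice ⟩
    xAbove (suc j) Q ⊞ M          ≈⟨ +-congʳ (xAbove-cong (suc j) X⊠P₂≐Q) ⟨
    xAbove (suc j) (X ⊠ P₂) ⊞ M   ≈⟨ +-congʳ (X-⊠-xAbove j P₂) ⟨
    X ⊠ xAbove j P₂ ⊞ M           ∎

  X⊠G₂≐Y⊠G₁⊞M : X ⊠ G₂ ≐ Y ⊠ G₁ ⊞ M
  X⊠G₂≐Y⊠G₁⊞M = ∙-cancelˡ (X ⊠ F₂) _ _ (begin
    X ⊠ F₂ ⊞ X ⊠ G₂         ≈⟨ distribˡ X F₂ G₂ ⟨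
    X ⊠ (F₂ ⊞ G₂)           ≈⟨ *-congˡ (xAbove-⊞-xUpTo j P₂) ⟩
    X ⊠ P₂                  ≈⟨ X⊠P₂≐Q ⟩
    Q                       ≈⟨ Y⊠P₁≐Q ⟨
    Y ⊠ P₁                  ≈⟨ *-congˡ (xAbove-⊞-xUpTo j P₁) ⟨
    Y ⊠ (F₁ ⊞ G₁)           ≈⟨ distribˡ Y F₁ G₁ ⟩
    Y ⊠ F₁ ⊞ Y ⊠ G₁         ≈⟨ +-congʳ Y⊠F₁≐X⊠F₂⊞M ⟩
    X ⊠ F₂ ⊞ M ⊞ Y ⊠ G₁     ≈⟨ solve 3 (λ a b c → a :+ b :+ c := a :+ (c :+ b)) 𝔽[x,y].refl (X ⊠ F₂) M (Y ⊠ G₁) ⟩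
    X ⊠ F₂ ⊞ (Y ⊠ G₁ ⊞ M)   ∎)

  module _ {c} (c-poly : IsPoly c) (c-homogeneous : Homogeneous 1 c) where

    split-homogeneous : Homogeneous (m + 1) (E ⊠ c)
    split-homogeneous = Homogeneous-⊠ E-homogeneous c-homogeneous

    split-YOrder≥ : YOrder≥ (suc r) (xUpTo j (E ⊠ c))
    split-YOrder≥ = YOrder≥-xUpTo j (suc r) (E ⊠ c) λ i k i≤j k≤r → split-homogeneous i k λ i+k≡m+1 → ℕ.<-irrefl i+k≡m+1
      (ℕ.≤-trans (s≤s (ℕ.≤-trans (ℕ.+-mono-≤ i≤j (ℕ.≤-pred k≤r)) (ℕ.≤-reflexive j+r≡m))) (ℕ.≤-reflexive (ℕ.+-comm 1 m)))

    split-InD : InD p μ (xAbove j (E ⊠ c) , xUpTo j (E ⊠ c))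
    split-InD = Equivalence.from (InD-μ⇔ _ _)
      ( IsPoly-xAbove j Ec-poly , IsPoly-xUpTo j Ec-poly , XOrder≥-xAbove j (E ⊠ c)
      , split-YOrder≥ , c , c-poly , xAbove-⊞-xUpTo j (E ⊠ c))
      where
      Ec-poly : IsPoly (E ⊠ c)
      Ec-poly = IsPoly-⊠ E-poly c-poly

    split-HomD : HomD p (m + 1) (xAbove j (E ⊠ c) , xUpTo j (E ⊠ c))
    split-HomD = Equivalence.to (Homogeneous⇔HomP _ _) (Homogeneous-xAbove j split-homogeneous)
               , Equivalence.to (Homogeneous⇔HomP _ _) (Homogeneous-xUpTo j split-homogeneous)

  components-sum : ∀ h₁ h₂ → (h₁ ⊠ F₁ ⊞ h₂ ⊠ F₂) ⊞ (h₁ ⊠ G₁ ⊞ h₂ ⊠ G₂) ≐ E ⊠ (X ⊠ h₁ ⊞ Y ⊠ h₂)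
  components-sum h₁ h₂ = begin
    (h₁ ⊠ F₁ ⊞ h₂ ⊠ F₂) ⊞ (h₁ ⊠ G₁ ⊞ h₂ ⊠ G₂)
      ≈⟨ solve 6 (λ h₁ h₂ f₁ g₁ f₂ g₂ → (h₁ :* f₁ :+ h₂ :* f₂) :+ (h₁ :* g₁ :+ h₂ :* g₂) := h₁ :* (f₁ :+ g₁) :+ h₂ :* (f₂ :+ g₂))
          𝔽[x,y].refl h₁ h₂ F₁ G₁ F₂ G₂ ⟩
    h₁ ⊠ (F₁ ⊞ G₁) ⊞ h₂ ⊠ (F₂ ⊞ G₂)
      ≈⟨ +-cong (*-congˡ (xAbove-⊞-xUpTo j P₁)) (*-congˡ (xAbove-⊞-xUpTo j P₂)) ⟩
    h₁ ⊠ (E ⊠ X) ⊞ h₂ ⊠ (E ⊠ Y)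
      ≈⟨ solve 5 (λ h₁ h₂ e x y → h₁ :* (e :* x) :+ h₂ :* (e :* y) := e :* (x :* h₁ :+ y :* h₂)) 𝔽[x,y].refl h₁ h₂ E X Y ⟩
    E ⊠ (X ⊠ h₁ ⊞ Y ⊠ h₂) ∎

  φ-independent : Independent φ₁ φ₂
  φ-independent h₁ h₂ _ _ (f-comb≐0 , g-comb≐0) = h₁≐0 , h₂≐0
    where
    Xh₁+Yh₂≐0 : X ⊠ h₁ ⊞ Y ⊠ h₂ ≐ zeroP
    Xh₁+Yh₂≐0 = ^-⊠-cancel X⊞Y-⊠-cancel m (begin
      E ⊠ (X ⊠ h₁ ⊞ Y ⊠ h₂)                       ≈⟨ components-sum h₁ h₂ ⟨
      (h₁ ⊠ F₁ ⊞ h₂ ⊠ F₂) ⊞ (h₁ ⊠ G₁ ⊞ h₂ ⊠ G₂)   ≈⟨ +-cong f-comb≐0 g-comb≐0 ⟩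
      zeroP ⊞ zeroP                               ≈⟨ +-identityˡ zeroP ⟩
      zeroP                                       ∎)
    t : Coef
    t = shift 0 1 h₁
    h₁≐Yt : h₁ ≐ Y ⊠ t
    h₁≐Yt = proj₁ (X-Y-syzygy Xh₁+Yh₂≐0)
    h₂+Xt≐0 : h₂ ⊞ X ⊠ t ≐ zeroP
    h₂+Xt≐0 = proj₂ (X-Y-syzygy Xh₁+Yh₂≐0)
    t≐0 : t ≐ zeroP
    t≐0 = monomial-⊠-cancel p-prime (suc j) (suc r) p∤C (begin
      M ⊠ t
        ≈⟨ +-identityʳ (M ⊠ t) ⟨
      M ⊠ t ⊞ zeroP
        ≈⟨ +-congˡ (𝔽[x,y].trans (*-congʳ h₂+Xt≐0) (zeroˡ F₂)) ⟨
      M ⊠ t ⊞ (h₂ ⊞ X ⊠ t) ⊠ F₂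
        ≈⟨ solve 5 (λ m t h₂ x f₂ → m :* t :+ (h₂ :+ x :* t) :* f₂ := h₂ :* f₂ :+ t :* (x :* f₂ :+ m))
            𝔽[x,y].refl M t h₂ X F₂ ⟩
      h₂ ⊠ F₂ ⊞ t ⊠ (X ⊠ F₂ ⊞ M)
        ≈⟨ +-congˡ (*-congˡ Y⊠F₁≐X⊠F₂⊞M) ⟨
      h₂ ⊠ F₂ ⊞ t ⊠ (Y ⊠ F₁)
        ≈⟨ solve 5 (λ h₂ f₂ t y f₁ → h₂ :* f₂ :+ t :* (y :* f₁) := (y :* t) :* f₁ :+ h₂ :* f₂)
            𝔽[x,y].refl h₂ F₂ t Y F₁ ⟩
      (Y ⊠ t) ⊠ F₁ ⊞ h₂ ⊠ F₂
        ≈⟨ +-congʳ (*-congʳ h₁≐Yt) ⟨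
      h₁ ⊠ F₁ ⊞ h₂ ⊠ F₂
        ≈⟨ f-comb≐0 ⟩
      zeroP                                ∎)
    h₁≐0 : h₁ ≐ zeroP
    h₁≐0 = 𝔽[x,y].trans h₁≐Yt (𝔽[x,y].trans (*-congˡ t≐0) (zeroʳ Y))
    h₂≐0 : h₂ ≐ zeroP
    h₂≐0 = begin
      h₂              ≈⟨ +-identityʳ h₂ ⟨
      h₂ ⊞ zeroP      ≈⟨ +-congˡ (𝔽[x,y].trans (*-congˡ t≐0) (zeroʳ X)) ⟨
      h₂ ⊞ X ⊠ t      ≈⟨ h₂+Xt≐0 ⟩
      zeroP           ∎

  module Spanning {f g c} (f-poly : IsPoly f) (g-poly : IsPoly g) (f-x : XOrder≥ (suc j) f) (g-y : YOrder≥ (suc r) g)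
                  (c-poly : IsPoly c) (f+g≐Ec : f ⊞ g ≐ E ⊠ c) where

    open AbelianGroupProperties 𝔽[x,y].+-abelianGroup using (∙-cancelʳ; inverseˡ-unique; ⁻¹-∙-comm)

    h₁ h₂ W₁ W₂ R S : Coef
    h₁ = shift 1 0 c
    h₂ = xUpTo 0 (shift 0 1 c)
    W₁ = h₁ ⊠ F₁ ⊞ h₂ ⊠ F₂
    W₂ = h₁ ⊠ G₁ ⊞ h₂ ⊠ G₂
    R  = f ⊞ ⊟ W₁
    S  = g ⊞ ⊟ W₂

    R⊞S≐E⊠c₀ : R ⊞ S ≐ E ⊠ scalar (c 0 0)
    R⊞S≐E⊠c₀ = begin
      (f ⊞ ⊟ W₁) ⊞ (g ⊞ ⊟ W₂)
        ≈⟨ solve 4 (λ f n₁ g n₂ → (f :+ n₁) :+ (g :+ n₂) := (f :+ g) :+ (n₁ :+ n₂)) 𝔽[x,y].refl f (⊟ W₁) g (⊟ W₂) ⟩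
      (f ⊞ g) ⊞ (⊟ W₁ ⊞ ⊟ W₂)
        ≈⟨ +-cong f+g≐Ec (⁻¹-∙-comm W₁ W₂) ⟩
      E ⊠ c ⊞ ⊟ (W₁ ⊞ W₂)
        ≈⟨ +-cong (*-congˡ (constant-term-split c)) (-‿cong (components-sum h₁ h₂)) ⟩
      E ⊠ (A ⊞ scalar (c 0 0)) ⊞ ⊟ (E ⊠ A)
        ≈⟨ solve 4 (λ e a b n → e :* (a :+ b) :+ n := e :* b :+ (e :* a :+ n)) 𝔽[x,y].refl E A (scalar (c 0 0)) (⊟ (E ⊠ A)) ⟩
      E ⊠ scalar (c 0 0) ⊞ (E ⊠ A ⊞ ⊟ (E ⊠ A))
        ≈⟨ +-congˡ (-‿inverseʳ (E ⊠ A)) ⟩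
      E ⊠ scalar (c 0 0) ⊞ zeroP
        ≈⟨ +-identityʳ _ ⟩
      E ⊠ scalar (c 0 0)                         ∎
      where
      A : Coef
      A = X ⊠ h₁ ⊞ Y ⊠ h₂

    R-x : XOrder≥ (suc j) R
    R-x = XOrder≥-⊞ f-x (XOrder≥-⊟ (XOrder≥-⊞ (XOrder≥-⊠ˡ h₁ (XOrder≥-xAbove j P₁)) (XOrder≥-⊠ˡ h₂ (XOrder≥-xAbove j P₂))))

    S-y : YOrder≥ (suc r) S
    S-y = YOrder≥-⊞ g-y (YOrder≥-⊟ (YOrder≥-⊞ (YOrder≥-⊠ˡ h₁ (split-YOrder≥ IsPoly-X X-homogeneous))
                                               (YOrder≥-⊠ˡ h₂ (split-YOrder≥ IsPoly-Y Y-homogeneous))))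

    -- Read off at x^j y^r, where R and S vanish while E has the coefficient (m C j).
    c₀≃0 : c 0 0 ≃ 0
    c₀≃0 = *-cancelˡ-≃0 p-prime p∤C (ℤₚ.trans (ℤₚ.sym (Ec₀-corner)) (ℤₚ.trans (ℤₚ.sym (coeff R⊞S≐E⊠c₀ j r))
             (ℤₚ.trans (⊞-coeff-≃ R S j r) (ℤₚ.trans (ℤₚ.+-cong (R-x j r (ℕ.n<1+n j)) (S-y j r (ℕ.n<1+n r))) (ℤₚ.+-identityˡ 0)))))
      where
      Ec₀-corner : (E ⊠ scalar (c 0 0)) j r ≃ (m C j) * c 0 0
      Ec₀-corner = ℤₚ.trans (coeff (*-comm E (scalar (c 0 0))) j r) (ℤₚ.trans (scalar-⊠-coeff (c 0 0) E j r)
                     (ℤₚ.trans (ℤₚ.*-congˡ {c 0 0} (E-coeff-row r)) (≃-reflexive (trans (cong (λ d → c 0 0 * (d * (m C j))) (δ-refl r))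
                       (trans (cong (c 0 0 *_) (ℕ.*-identityˡ (m C j))) (ℕ.*-comm (c 0 0) (m C j)))))))

    R⊞S≐0 : R ⊞ S ≐ zeroP
    R⊞S≐0 = 𝔽[x,y].trans R⊞S≐E⊠c₀ (𝔽[x,y].trans (*-congˡ (scalar-≃0 c₀≃0)) (zeroʳ E))

    R-y : YOrder≥ (suc r) R
    R-y = YOrder≥-resp-≐ (inverseˡ-unique R S R⊞S≐0) (YOrder≥-⊟ S-y)

    c⁻¹ : ℕ
    c⁻¹ = proj₁ (inverse p-prime p∤C)

    s′ : Coef
    s′ = scalar c⁻¹ ⊠ shift (suc j) (suc r) R

    R≐s′⊠M : R ≐ s′ ⊠ M
    R≐s′⊠M = begin
      R
        ≈⟨ monomial-factor (suc j) (suc r) R-x R-y ⟩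
      monomial 1 (suc j) (suc r) ⊠ s
        ≈⟨ *-congʳ (monomial-cong (suc j) (suc r) (proj₂ (inverse p-prime p∤C))) ⟨
      monomial (c⁻¹ * (m C j)) (suc j) (suc r) ⊠ s
        ≈⟨ *-congʳ (monomial-⊠-monomial c⁻¹ 0 0 (m C j) (suc j) (suc r)) ⟨
      (scalar c⁻¹ ⊠ M) ⊠ s
        ≈⟨ solve 3 (λ a b c → (a :* b) :* c := (a :* c) :* b) 𝔽[x,y].refl (scalar c⁻¹) M s ⟩
      s′ ⊠ M                                              ∎
      where
      s : Coef
      s = shift (suc j) (suc r) R

    H₁ H₂ : Coef
    H₁ = h₁ ⊞ Y ⊠ s′
    H₂ = h₂ ⊞ ⊟ (X ⊠ s′)

    H-expansion : ∀ A B → H₁ ⊠ A ⊞ H₂ ⊠ B ⊞ (X ⊠ s′) ⊠ B ≐ h₁ ⊠ A ⊞ h₂ ⊠ B ⊞ s′ ⊠ (Y ⊠ A)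
    H-expansion A B = begin
      H₁ ⊠ A ⊞ H₂ ⊠ B ⊞ (X ⊠ s′) ⊠ B
        ≈⟨ +-assoc _ _ _ ⟩
      H₁ ⊠ A ⊞ (H₂ ⊠ B ⊞ (X ⊠ s′) ⊠ B)
        ≈⟨ +-congˡ (distribʳ B H₂ (X ⊠ s′)) ⟨
      H₁ ⊠ A ⊞ (H₂ ⊞ X ⊠ s′) ⊠ B
        ≈⟨ +-congˡ (*-congʳ h₂-recovered) ⟩
      (h₁ ⊞ Y ⊠ s′) ⊠ A ⊞ h₂ ⊠ B
        ≈⟨ solve 6 (λ h₁ y s a h₂ b → (h₁ :+ y :* s) :* a :+ h₂ :* b := h₁ :* a :+ h₂ :* b :+ s :* (y :* a))
            𝔽[x,y].refl h₁ Y s′ A h₂ B ⟩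
      h₁ ⊠ A ⊞ h₂ ⊠ B ⊞ s′ ⊠ (Y ⊠ A)             ∎
      where
      h₂-recovered : H₂ ⊞ X ⊠ s′ ≐ h₂
      h₂-recovered = 𝔽[x,y].trans (+-assoc h₂ _ _) (𝔽[x,y].trans (+-congˡ (-‿inverseˡ (X ⊠ s′))) (+-identityʳ h₂))

    f≐ : f ≐ H₁ ⊠ F₁ ⊞ H₂ ⊠ F₂
    f≐ = ∙-cancelʳ ((X ⊠ s′) ⊠ F₂) _ _ (begin
      f ⊞ (X ⊠ s′) ⊠ F₂
        ≈⟨ +-congʳ W₁⊞R≐f ⟨
      W₁ ⊞ R ⊞ (X ⊠ s′) ⊠ F₂
        ≈⟨ +-congʳ (+-congˡ R≐s′⊠M) ⟩
      W₁ ⊞ s′ ⊠ M ⊞ (X ⊠ s′) ⊠ F₂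
        ≈⟨ solve 5 (λ w s m x f → w :+ s :* m :+ (x :* s) :* f := w :+ s :* (x :* f :+ m)) 𝔽[x,y].refl W₁ s′ M X F₂ ⟩
      W₁ ⊞ s′ ⊠ (X ⊠ F₂ ⊞ M)
        ≈⟨ +-congˡ (*-congˡ Y⊠F₁≐X⊠F₂⊞M) ⟨
      W₁ ⊞ s′ ⊠ (Y ⊠ F₁)
        ≈⟨ H-expansion F₁ F₂ ⟨
      H₁ ⊠ F₁ ⊞ H₂ ⊠ F₂ ⊞ (X ⊠ s′) ⊠ F₂     ∎)
      where
      W₁⊞R≐f : W₁ ⊞ R ≐ f
      W₁⊞R≐f = 𝔽[x,y].trans (+-comm W₁ R) (𝔽[x,y].trans (+-assoc f _ W₁)
                 (𝔽[x,y].trans (+-congˡ (-‿inverseˡ W₁)) (+-identityʳ f)))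

    g≐ : g ≐ H₁ ⊠ G₁ ⊞ H₂ ⊠ G₂
    g≐ = ∙-cancelʳ ((X ⊠ s′) ⊠ G₂) _ _ (begin
      g ⊞ (X ⊠ s′) ⊠ G₂
        ≈⟨ solve 4 (λ g x s b → g :+ (x :* s) :* b := g :+ s :* (x :* b)) 𝔽[x,y].refl g X s′ G₂ ⟩
      g ⊞ s′ ⊠ (X ⊠ G₂)
        ≈⟨ +-congˡ (*-congˡ X⊠G₂≐Y⊠G₁⊞M) ⟩
      g ⊞ s′ ⊠ (Y ⊠ G₁ ⊞ M)
        ≈⟨ solve 4 (λ g s a m → g :+ s :* (a :+ m) := g :+ s :* m :+ s :* a) 𝔽[x,y].refl g s′ (Y ⊠ G₁) M ⟩
      g ⊞ s′ ⊠ M ⊞ s′ ⊠ (Y ⊠ G₁)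
        ≈⟨ +-congʳ (+-congˡ R≐s′⊠M) ⟨
      g ⊞ R ⊞ s′ ⊠ (Y ⊠ G₁)
        ≈⟨ +-congʳ g⊞R≐W₂ ⟩
      W₂ ⊞ s′ ⊠ (Y ⊠ G₁)
        ≈⟨ H-expansion G₁ G₂ ⟨
      H₁ ⊠ G₁ ⊞ H₂ ⊠ G₂ ⊞ (X ⊠ s′) ⊠ G₂     ∎)
      where
      g⊞R≐W₂ : g ⊞ R ≐ W₂
      g⊞R≐W₂ = begin
        g ⊞ R
          ≈⟨ +-identityʳ _ ⟨
        g ⊞ R ⊞ zeroP
          ≈⟨ +-congˡ (-‿inverseʳ W₂) ⟨
        g ⊞ R ⊞ (W₂ ⊞ ⊟ W₂)
          ≈⟨ solve 4 (λ g r w n → g :+ r :+ (w :+ n) := w :+ (r :+ (g :+ n))) 𝔽[x,y].refl g R W₂ (⊟ W₂) ⟩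
        W₂ ⊞ (R ⊞ S)
          ≈⟨ +-congˡ R⊞S≐0 ⟩
        W₂ ⊞ zeroP
          ≈⟨ +-identityʳ W₂ ⟩
        W₂                           ∎

    h₁-poly : IsPoly h₁
    h₁-poly = IsPoly-shift 1 0 c-poly

    h₂-poly : IsPoly h₂
    h₂-poly = IsPoly-xUpTo 0 (IsPoly-shift 0 1 c-poly)

    s′-poly : IsPoly s′
    s′-poly = IsPoly-⊠ (IsPoly-monomial c⁻¹ 0 0) (IsPoly-shift (suc j) (suc r) R-poly)
      where
      F-poly : ∀ {c} → IsPoly c → IsPoly (xAbove j (E ⊠ c))
      F-poly c-poly = IsPoly-xAbove j (IsPoly-⊠ E-poly c-poly)
      R-poly : IsPoly R
      R-poly = IsPoly-⊞ f-poly (IsPoly-⊟ (IsPoly-⊞ (IsPoly-⊠ h₁-poly (F-poly IsPoly-X)) (IsPoly-⊠ h₂-poly (F-poly IsPoly-Y))))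

    H₁-poly : IsPoly H₁
    H₁-poly = IsPoly-⊞ h₁-poly (IsPoly-⊠ IsPoly-Y s′-poly)

    H₂-poly : IsPoly H₂
    H₂-poly = IsPoly-⊞ h₂-poly (IsPoly-⊟ (IsPoly-⊠ IsPoly-X s′-poly))

  φ-spans : Spans μ φ₁ φ₂
  φ-spans (f , g) θ∈ with Equivalence.to (InD-μ⇔ f g) θ∈
  ... | f-poly , g-poly , f-x , g-y , c , c-poly , f+g≐Ec = H₁ , H₂ , H₁-poly , H₂-poly , f≐ , g≐
    where open Spanning f-poly g-poly f-x g-y c-poly f+g≐Ec

  φ-exponents : HasExponents p μ (m + 1) (m + 1)
  φ-exponents = φ₁ , φ₂
              , Equivalence.from (IsBasis⇔ μ φ₁ φ₂) (split-InD IsPoly-X X-homogeneous , split-InD IsPoly-Y Y-homogeneous , φ-spans , φ-independent)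
              , split-HomD IsPoly-X X-homogeneous , split-HomD IsPoly-Y Y-homogeneous

module UnequalExponents (p : ℕ) .{{_ : NonZero p}} (p-prime : Prime p) (m j : ℕ) (j≤m : j ≤ m) (p∣C : p ∣ m C j) where

  open Multiplicity p m j j≤m

  ψ : Der
  ψ = xAbove j E , xUpTo j E

  from-HomP : ∀ {d f} → HomP p d f → Homogeneous d f
  from-HomP = Equivalence.from (Homogeneous⇔HomP _ _)

  C≃0 : m C j ≃ 0
  C≃0 = Equivalence.from ≃0⇔∣ p∣C

  j<m : j < m
  j<m with ℕ.m≤n⇒m<n∨m≡n j≤m
  ... | inj₁ j<m = j<m
  ... | inj₂ refl = ⊥-elim (1≄0 p-prime (ℤₚ.trans (≃-reflexive (sym (nCn≡1 j))) C≃0))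

  ψ-InD : InD p μ ψ
  ψ-InD = Equivalence.from (InD-μ⇔ _ _)
    ( IsPoly-xAbove j E-poly , IsPoly-xUpTo j E-poly , XOrder≥-xAbove j E
    , YOrder≥-xUpTo j (suc r) E E-below-corner , oneP , IsPoly-oneP
    , 𝔽[x,y].trans (xAbove-⊞-xUpTo j E) (𝔽[x,y].sym (*-identityʳ E)))
    where
    -- Below the corner x^j y^r everything has degree < m, and the corner itself is (m C j) ≃ 0.
    E-below-corner : ∀ i k → i ≤ j → k < suc r → E i k ≃ 0
    E-below-corner i k i≤j k≤r with (i ≟ j) ×-dec (k ≟ r)
    ... | yes (refl , refl) = ℤₚ.trans (E-coeff-row r)
                                (ℤₚ.trans (≃-reflexive (cong (_* (m C i)) (δ-refl r))) (ℤₚ.trans (ℤₚ.*-identityˡ _) C≃0))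
    ... | no ¬corner = E-homogeneous i k λ i+k≡m → ℕ.<-irrefl i+k≡m
                         (ℕ.<-≤-trans (+-mono-≤-≢-< i≤j (ℕ.≤-pred k≤r) ¬corner) (ℕ.≤-reflexive j+r≡m))

  ψf-leading : xAbove j E m 0 ≃ 1
  ψf-leading = ℤₚ.trans (≃-reflexive (xAbove-yes j<m E 0)) E-coeff-m0

  proportional-to-ψ : ∀ {d f g} → InD p μ (f , g) → Homogeneous d f → Homogeneous d g → d ≤ m →
                      ∃[ c₀ ] (f , g) ≐D scalar c₀ ·D ψ
  proportional-to-ψ {d} {f} {g} θ∈ f-hom g-hom d≤m with Equivalence.to (InD-μ⇔ f g) θ∈
  ... | _ , _ , f-x , g-y , c , _ , f+g≐Ec = c₀ , coeffwise (scaled f (xAbove j E) λ i k → proj₁ (both i k))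
                                                , coeffwise (scaled g (xUpTo j E) λ i k → proj₂ (both i k))
    where
    c₀ : ℕ
    c₀ = c 0 0
    scaled : ∀ u v → (∀ i k → u i k ≃ c₀ * v i k) → ∀ i k → u i k ≃ (scalar c₀ ⊠ v) i k
    scaled u v u≃c₀v i k = ℤₚ.trans (u≃c₀v i k) (ℤₚ.sym (scalar-⊠-coeff c₀ v i k))
    0≃c₀*0 : 0 ≃ c₀ * 0
    0≃c₀*0 = ℤₚ.sym (ℤₚ.zeroʳ c₀)
    f+g≃c₀E : ∀ i k → i + k ≤ m → f i k + g i k ≃ c₀ * E i k
    f+g≃c₀E i k i+k≤m = ℤₚ.trans (ℤₚ.sym (⊞-coeff-≃ f g i k))
      (ℤₚ.trans (coeff f+g≐Ec i k) (ℤₚ.trans (Homogeneous-⊠-coeff E-homogeneous c i k i+k≤m) (ℤₚ.*-comm (E i k) c₀)))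
    above-m : ∀ i k → ¬ i + k ≤ m → f i k ≃ 0 × g i k ≃ 0 × E i k ≃ 0
    above-m i k i+k≰m = f-hom i k i+k≢d , g-hom i k i+k≢d , E-homogeneous i k (i+k≰m ∘ ℕ.≤-reflexive)
      where
      i+k≢d : i + k ≢ d
      i+k≢d i+k≡d = i+k≰m (ℕ.≤-trans (ℕ.≤-reflexive i+k≡d) d≤m)
    both : ∀ i k → f i k ≃ c₀ * xAbove j E i k × g i k ≃ c₀ * xUpTo j E i k
    both i k with i + k ≤? m | j <? i
    ... | yes i+k≤m | yes j<i = ℤₚ.trans (ℤₚ.sym (ℤₚ.trans (ℤₚ.+-congˡ {f i k} g≃0) (ℤₚ.+-identityʳ (f i k)))) (f+g≃c₀E i k i+k≤m)
                              , ℤₚ.trans g≃0 0≃c₀*0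
      where
      g≃0 : g i k ≃ 0
      g≃0 = g-y i k (s≤s (ℕ.+-cancelˡ-≤ j k r (ℕ.≤-trans (ℕ.+-monoˡ-≤ k (ℕ.<⇒≤ j<i)) (ℕ.≤-trans i+k≤m (ℕ.≤-reflexive (sym j+r≡m))))))
    ... | yes i+k≤m | no j≮i = ℤₚ.trans f≃0 0≃c₀*0
                             , ℤₚ.trans (ℤₚ.sym (ℤₚ.trans (ℤₚ.+-congʳ {g i k} f≃0) (ℤₚ.+-identityˡ (g i k)))) (f+g≃c₀E i k i+k≤m)
      where
      f≃0 : f i k ≃ 0
      f≃0 = f-x i k (s≤s (ℕ.≮⇒≥ j≮i))
    ... | no i+k≰m | yes _ = let (f≃0 , g≃0 , E≃0) = above-m i k i+k≰m in
                             ℤₚ.trans f≃0 (ℤₚ.sym (*-zeroʳ-≃ c₀ E≃0)) , ℤₚ.trans g≃0 0≃c₀*0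
    ... | no i+k≰m | no _  = let (f≃0 , g≃0 , E≃0) = above-m i k i+k≰m in
                             ℤₚ.trans f≃0 0≃c₀*0 , ℤₚ.trans g≃0 (ℤₚ.sym (*-zeroʳ-≃ c₀ E≃0))

  no-equal-exponents : ∀ d → ¬ HasExponents p μ d d
  no-equal-exponents d (θ₁ , θ₂ , basis , (f₁-hom , g₁-hom) , (f₂-hom , g₂-hom))
    with Equivalence.to (IsBasis⇔ μ θ₁ θ₂) basis | d ≤? m
  ... | θ₁∈ , θ₂∈ , _ , independent | yes d≤m =
    let (c₁ , θ₁≐c₁ψ) = proportional-to-ψ θ₁∈ (from-HomP f₁-hom) (from-HomP g₁-hom) d≤m
        (c₂ , θ₂≐c₂ψ) = proportional-to-ψ θ₂∈ (from-HomP f₂-hom) (from-HomP g₂-hom) d≤m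
    in proportional⇒¬independent p-prime ψ c₁ c₂ θ₁≐c₁ψ θ₂≐c₂ψ independent
  ... | _ , _ , spans , _ | no d≰m =
    let (h₁ , h₂ , _ , _ , ψf≐ , _) = spans ψ ψ-InD in
    1≄0 p-prime (begin
      1                                           ≈⟨ ψf-leading ⟨
      xAbove j E m 0                              ≈⟨ coeff ψf≐ m 0 ⟩
      (h₁ ⊠ proj₁ θ₁ ⊞ h₂ ⊠ proj₁ θ₂) m 0        ≈⟨ ⊞-coeff-≃ _ _ m 0 ⟩
      (h₁ ⊠ proj₁ θ₁) m 0 + (h₂ ⊠ proj₁ θ₂) m 0  ≈⟨ ℤₚ.+-cong (Homogeneous-⊠-below (from-HomP f₁-hom) h₁ m 0 m+0<d)
                                                              (Homogeneous-⊠-below (from-HomP f₂-hom) h₂ m 0 m+0<d) ⟩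
      0 + 0                                       ≈⟨ ℤₚ.+-identityˡ 0 ⟩
      0                                           ∎)
    where
    open import Relation.Binary.Reasoning.Setoid ℤₚ.setoid
    m+0<d : m + 0 < d
    m+0<d = subst (_< d) (sym (ℕ.+-identityʳ m)) (ℕ.≰⇒> d≰m)

corollary5p13 : (p : ℕ) → Prime p → (m : ℕ) → 1 ≤ m → (j : ℕ) → j ≤ m →
    ((¬ (p ∣ (m C j))) ⇔ IsΔ p (j + 1 , (m + 1) ∸ j , m) 0)
corollary5p13 p p-prime m _ j j≤m = mk⇔
  (λ p∤C → m + 1 , m + 1 , EqualExponents.φ-exponents p p-prime m j j≤m p∤C , sym (ℕ.∣n-n∣≡0 (m + 1)))
  (λ (d₁ , d₂ , exponents , 0≡∣d₁-d₂∣) p∣C → UnequalExponents.no-equal-exponents p p-prime m j j≤m p∣C d₁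
     (subst (HasExponents p (j + 1 , (m + 1) ∸ j , m) d₁) (sym (ℕ.∣m-n∣≡0⇒m≡n (sym 0≡∣d₁-d₂∣))) exponents))
  where
  instance
    p-nonZero : NonZero p
    p-nonZero = prime⇒nonZero p-prime
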